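{- Let $k$ be a positive integer and $\alpha$ an integer. Then, as formal power series in $q$, $$C\Phi_{k,\alpha}(q)=\frac{1}{(q;q)^k_{\infty}}\sum_{m_1,m_2,\dots,m_{k-1}=-\infty}^{\infty}q^{Q(m_1,\dots,m_{k-1})},$$ where $$Q(m_1,\dots,m_{k-1})=m_1^2+m_2^2+\cdots+m_{k-1}^2-\alpha(m_1+m_2+\cdots+m_{k-1})+\sum_{1\le i<j\le k-1}m_im_j+\frac{\alpha^2+\alpha}{2}.$$ (For $k=1$ the sum consists of the single term $q^{(\alpha^2+\alpha)/2}$.)
   Context: $(q;q)_\infty=\prod_{n=1}^\infty(1-q^n)$. For a positive integer $k$ and an integer $\alpha$, $C\Phi_{k,\alpha}(q)=\sum_{n\ge0}c\phi_{k,\alpha}(n)q^n$ is defined as the coefficient of $z^{\alpha}$ in the formal product $$\prod_{\lambda=0}^{\infty}(1+zq^{\lambda+1})^k(1+z^{ -1}q^{\lambda})^k.$$ Combinatorially, $c\phi_{k,\alpha}(n)$ counts two-rowed arrays (top row with $m_1$ entries, bottom row with $m_2$ entries, row difference $m_1-m_2=\alpha$) whose entries are nonnegative integers each carrying one of $k$ colors, with no colored integer repeated within a row, and of weight $m_1+(\text{sum of all entries})=n$. -}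

module Defs where

open import Data.Nat as ℕ using (ℕ; zero; suc; _∸_; _≤ᵇ_)
open import Data.Integer as ℤ using (ℤ; +_; -_; _+_; _-_; _*_)
open import Data.Bool using (Bool; true; false; if_then_else_; _∧_)
open import Data.List using (List; []; _∷_; _++_; map; upTo; replicate; concatMap; foldr)
open import Data.Vec as V using (Vec; []; _∷_)
open import Data.Product using (_×_; _,_)
open import Relation.Nullary.Decidable using (⌊_⌋)

-- Left-hand side: c φ_{k,α}(n), the coefficient of z^α q^n in
--   ∏_{λ ≥ 0} (1 + z q^{λ+1})^k (1 + z^{-1} q^λ)^k .

-- A factor (1 + z^a q^b) is encoded by the pair (a , b).
Factor : Set
Factor = ℤ × ℕ

-- coeffProd L α n = coefficient of z^α q^n in the finite product ∏_{(a,b) ∈ L} (1 + z^a q^b),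
-- computed by expanding the first factor: 1·(rest) + z^a q^b·(rest).
coeffProd : List Factor → ℤ → ℕ → ℕ
coeffProd [] α n = if ⌊ α ℤ.≟ + 0 ⌋ ∧ ⌊ n ℕ.≟ 0 ⌋ then 1 else 0
coeffProd ((a , b) ∷ L) α n =
  coeffProd L α n ℕ.+ (if b ≤ᵇ n then coeffProd L (α - a) (n ∸ b) else 0)

-- The factors (1 + z q^{λ+1})^k (1 + z^{-1} q^λ)^k for λ = 0, …, N.
-- Factors with λ > N have q-degree > N, so they do not affect the coefficient of q^n for n ≤ N.
factors : ℕ → ℕ → List Factor
factors k N = concatMap (λ l → replicate k (+ 1 , suc l) ++ replicate k (- (+ 1) , l)) (upTo (suc N))

cφ : ℕ → ℤ → ℕ → ℕ
cφ k α n = coeffProd (factors k n) α n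

Series : Set
Series = ℕ → ℤ

_⊛_ : Series → Series → Series
(f ⊛ g) n = foldr _+_ (+ 0) (map (λ i → f i * g (n ∸ i)) (upTo (suc n)))

𝟙 : Series
𝟙 zero = + 1
𝟙 (suc _) = + 0

-- the polynomial 1 - q^m (for m ≥ 1)
oneMinusQ^ : ℕ → Series
oneMinusQ^ m zero = + 1
oneMinusQ^ m (suc j) = if ⌊ suc j ℕ.≟ m ⌋ then - (+ 1) else + 0

eulerPartial : ℕ → Series
eulerPartial zero = 𝟙
eulerPartial (suc m) = eulerPartial m ⊛ oneMinusQ^ (suc m)

-- (q;q)_∞ = ∏_{m ≥ 1} (1 - q^m); its q^n coefficient only depends on factors with m ≤ n.
qPochInf : Series
qPochInf n = eulerPartial n n

_^ˢ_ : Series → ℕ → Series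
f ^ˢ zero = 𝟙
f ^ˢ suc k = f ⊛ (f ^ˢ k)

CΦ : ℕ → ℤ → Series
CΦ k α n = + cφ k α n

sumℤ : ∀ {r} → Vec ℤ r → ℤ
sumℤ = V.foldr _ _+_ (+ 0)

sumSq : ∀ {r} → Vec ℤ r → ℤ
sumSq = V.foldr _ (λ x s → x * x + s) (+ 0)

pairSum : ∀ {r} → Vec ℤ r → ℤ
pairSum [] = + 0
pairSum (x ∷ xs) = x * sumℤ xs + pairSum xs

-- 2·Q(m_1,…,m_{k-1}) (doubled so that (α²+α)/2 needs no division):
-- 2(Σ m_i² - α Σ m_i + Σ_{i<j} m_i m_j) + α² + α
twiceQ : ∀ {r} → ℤ → Vec ℤ r → ℤ
twiceQ α m = + 2 * (sumSq m - α * sumℤ m + pairSum m) + (α * α + α)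

-- The finite Jacobi triple product
--   ∏_{λ<u} (1 + z q^{λ+1}) (1 + z⁻¹ q^λ) = Σ_α z^α q^{α(α+1)/2} [2u, u+α]_q
-- follows by induction on u from a four-term recurrence for Gaussian binomials. As
-- (q;q)_∞ [2u, u+α]_q ≡ 1 modulo q^{u+1-|α|}, the coefficient of q^n in
-- (q;q)_∞^k CΦ_{k,α} is the coefficient of z^α q^n in (Σ_β z^β q^{β(β+1)/2})^k, that is, the
-- number of (β₁, …, β_k) with Σ βᵢ = α and Σ βᵢ(βᵢ+1)/2 = n. Finally, with T(x) = x(x+1)/2,
-- Q(m₁, …, m_{k-1}) = T(m₁) + … + T(m_{k-1}) + T(α - m₁ - … - m_{k-1}), so these k-tuples are
-- in bijection with the solutions of Q = n.

module Submission where

open import Defs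
open import Level using (0ℓ)
open import Function using (_∘_; id)
open import Data.Bool using (true; false; if_then_else_)
open import Data.Empty using (⊥-elim)
open import Data.Maybe using (Maybe; just; nothing)
open import Data.Nat as ℕ using (ℕ; zero; suc; _∸_; _≤ᵇ_; z≤n; s≤s)
import Data.Nat.Properties as ℕP
open import Data.Nat.Tactic.RingSolver using () renaming (solve-∀ to solveℕ)
open import Data.Integer as ℤ using (ℤ; +_; -[1+_]; _+_; _-_; -_)
import Data.Integer.Properties as ℤP
open import Data.Integer.Tactic.RingSolver using () renaming (solve-∀ to solveℤ)
open import Data.List using (List; []; _∷_; _++_; length; upTo; applyUpTo; replicate; concatMap; foldr)
import Data.List.Properties as LP
open import Data.List.Relation.Unary.All using (All; []; _∷_)
open import Data.List.Relation.Unary.All.Properties using (++⁺; replicate⁺)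
open import Data.Vec using (Vec; []; _∷_)
open import Data.Fin as Fin using (Fin; toℕ; fromℕ<)
import Data.Fin.Properties as FP
open import Data.Product using (Σ; Σ-syntax; _×_; _,_; proj₁; proj₂)
import Data.Product.Function.Dependent.Propositional as Σ
open import Data.Product.Function.NonDependent.Propositional using (_×-↔_)
open import Data.Sum using (_⊎_; inj₁; inj₂)
open import Data.Sum.Function.Propositional using (_⊎-↔_)
open import Function.Bundles using (_↔_; mk↔ₛ′)
open import Function.Properties.Inverse using (↔-refl; ↔-sym; ↔-trans)
open import Axiom.UniquenessOfIdentityProofs using (module Decidable⇒UIP)
open import Relation.Nullary using (Dec; yes; no)
open import Relation.Nullary.Negation using (contradiction)
open import Relation.Binary.Definitions using (tri<; tri≈; tri>)
open import Relation.Binary.PropositionalEquality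
open import Relation.Binary.Structures using (IsEquivalence)
open import Relation.Binary.Bundles using (Setoid)
import Relation.Binary.Reasoning.Setoid as SetoidReasoning
open import Algebra.Structures using (IsCommutativeRing)
open import Algebra.Bundles using (CommutativeRing)
import Algebra.Solver.Ring
import Algebra.Solver.Ring.AlmostCommutativeRing as ACR

sumBelow : ℕ → (ℕ → ℤ) → ℤ
sumBelow m h = foldr _+_ (+ 0) (applyUpTo h m)

module _ where
  open import Data.Integer using (_*_)
  open ≡-Reasoning

  sumBelow-cong : ∀ m {h h′} → (∀ i → i ℕ.< m → h i ≡ h′ i) → sumBelow m h ≡ sumBelow m h′
  sumBelow-cong zero e = refl
  sumBelow-cong (suc m) e = cong₂ _+_ (e 0 (s≤s z≤n)) (sumBelow-cong m (λ i p → e (suc i) (s≤s p)))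

  sumBelow-+ : ∀ m h h′ → sumBelow m (λ i → h i + h′ i) ≡ sumBelow m h + sumBelow m h′
  sumBelow-+ zero h h′ = refl
  sumBelow-+ (suc m) h h′ = begin
    h 0 + h′ 0 + sumBelow m (λ i → h (suc i) + h′ (suc i))
      ≡⟨ cong (_+_ (h 0 + h′ 0)) (sumBelow-+ m (h ∘ suc) (h′ ∘ suc)) ⟩
    h 0 + h′ 0 + (sumBelow m (h ∘ suc) + sumBelow m (h′ ∘ suc))
      ≡⟨ interchange (h 0) (h′ 0) _ _ ⟩
    h 0 + sumBelow m (h ∘ suc) + (h′ 0 + sumBelow m (h′ ∘ suc)) ∎
    where
    interchange : ∀ a b c d → a + b + (c + d) ≡ a + c + (b + d)
    interchange = solveℤ

  sumBelow-*ˡ : ∀ m c h → sumBelow m (λ i → c * h i) ≡ c * sumBelow m h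
  sumBelow-*ˡ zero c h = sym (ℤP.*-zeroʳ c)
  sumBelow-*ˡ (suc m) c h =
    trans (cong (_+_ (c * h 0)) (sumBelow-*ˡ m c (h ∘ suc))) (sym (ℤP.*-distribˡ-+ c (h 0) _))

  sumBelow-zero : ∀ m h → (∀ i → h i ≡ + 0) → sumBelow m h ≡ + 0
  sumBelow-zero zero h e = refl
  sumBelow-zero (suc m) h e = cong₂ _+_ (e 0) (sumBelow-zero m (h ∘ suc) (e ∘ suc))

  sumBelow-snoc : ∀ m h → sumBelow (suc m) h ≡ sumBelow m h + h m
  sumBelow-snoc zero h = trans (ℤP.+-identityʳ (h 0)) (sym (ℤP.+-identityˡ (h 0)))
  sumBelow-snoc (suc m) h =
    trans (cong (_+_ (h 0)) (sumBelow-snoc m (h ∘ suc))) (sym (ℤP.+-assoc (h 0) _ _))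

  sumBelow-reverse : ∀ n h → sumBelow (suc n) h ≡ sumBelow (suc n) (λ i → h (n ∸ i))
  sumBelow-reverse zero h = refl
  sumBelow-reverse (suc n) h = begin
    sumBelow (suc (suc n)) h                    ≡⟨ sumBelow-snoc (suc n) h ⟩
    sumBelow (suc n) h + h (suc n)              ≡⟨ cong (_+ h (suc n)) (sumBelow-reverse n h) ⟩
    sumBelow (suc n) (λ i → h (n ∸ i)) + h (suc n) ≡⟨ ℤP.+-comm _ (h (suc n)) ⟩
    h (suc n) + sumBelow (suc n) (λ i → h (n ∸ i)) ∎

-- Coefficientwise algebra of the Cauchy product

infix 4 _≈_ _≈[_]_

_≈_ : Series → Series → Set
f ≈ g = ∀ n → f n ≡ g n

_≈[_]_ : Series → ℕ → Series → Set
f ≈[ K ] g = ∀ n → n ℕ.< K → f n ≡ g n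

𝟘 : Series
𝟘 n = + 0

tail : Series → Series
tail f n = f (suc n)

module _ where
  open import Data.Integer using (_*_)
  open ≡-Reasoning

  ⊛-sumBelow : ∀ f g n → (f ⊛ g) n ≡ sumBelow (suc n) (λ i → f i * g (n ∸ i))
  ⊛-sumBelow f g n = cong (foldr _+_ (+ 0)) (LP.map-applyUpTo id (λ i → f i * g (n ∸ i)) (suc n))

  ⊛-zero : ∀ f g → (f ⊛ g) 0 ≡ f 0 * g 0
  ⊛-zero f g = ℤP.+-identityʳ _

  ⊛-suc : ∀ f g n → (f ⊛ g) (suc n) ≡ f 0 * g (suc n) + (tail f ⊛ g) n
  ⊛-suc f g n = trans (⊛-sumBelow f g (suc n)) (cong (_+_ (f 0 * g (suc n))) (sym (⊛-sumBelow (tail f) g n)))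

  ⊛-cong[] : ∀ {f f′ g g′} K → f ≈[ K ] f′ → g ≈[ K ] g′ → (f ⊛ g) ≈[ K ] (f′ ⊛ g′)
  ⊛-cong[] {f} {f′} {g} {g′} K ef eg n n<K = begin
    (f ⊛ g) n                               ≡⟨ ⊛-sumBelow f g n ⟩
    sumBelow (suc n) (λ i → f i * g (n ∸ i))   ≡⟨ sumBelow-cong (suc n) agree ⟩
    sumBelow (suc n) (λ i → f′ i * g′ (n ∸ i)) ≡⟨ ⊛-sumBelow f′ g′ n ⟨
    (f′ ⊛ g′) n                             ∎
    where
    agree : ∀ i → i ℕ.< suc n → f i * g (n ∸ i) ≡ f′ i * g′ (n ∸ i)
    agree i i≤n = cong₂ _*_ (ef i (ℕP.<-≤-trans i≤n n<K)) (eg (n ∸ i) (ℕP.≤-<-trans (ℕP.m∸n≤m n i) n<K))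

  ⊛-cong : ∀ {f f′ g g′} → f ≈ f′ → g ≈ g′ → (f ⊛ g) ≈ (f′ ⊛ g′)
  ⊛-cong ef eg n = ⊛-cong[] (suc n) (λ m _ → ef m) (λ m _ → eg m) n ℕP.≤-refl

  ⊛-comm : ∀ f g → (f ⊛ g) ≈ (g ⊛ f)
  ⊛-comm f g n = begin
    (f ⊛ g) n                                          ≡⟨ ⊛-sumBelow f g n ⟩
    sumBelow (suc n) (λ i → f i * g (n ∸ i))              ≡⟨ sumBelow-reverse n (λ i → f i * g (n ∸ i)) ⟩
    sumBelow (suc n) (λ i → f (n ∸ i) * g (n ∸ (n ∸ i))) ≡⟨ sumBelow-cong (suc n) swap ⟩
    sumBelow (suc n) (λ i → g i * f (n ∸ i))              ≡⟨ ⊛-sumBelow g f n ⟨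
    (g ⊛ f) n                                          ∎
    where
    swap : ∀ i → i ℕ.< suc n → f (n ∸ i) * g (n ∸ (n ∸ i)) ≡ g i * f (n ∸ i)
    swap i i≤n = trans (cong (λ j → f (n ∸ i) * g j) (ℕP.m∸[m∸n]≡n (ℕP.≤-pred i≤n))) (ℤP.*-comm (f (n ∸ i)) (g i))

  ⊛-distribʳ : ∀ f g h n → ((λ m → f m + g m) ⊛ h) n ≡ (f ⊛ h) n + (g ⊛ h) n
  ⊛-distribʳ f g h n = begin
    ((λ m → f m + g m) ⊛ h) n                     ≡⟨ ⊛-sumBelow (λ m → f m + g m) h n ⟩
    sumBelow (suc n) (λ i → (f i + g i) * h (n ∸ i)) ≡⟨ sumBelow-cong (suc n) (λ i _ → ℤP.*-distribʳ-+ (h (n ∸ i)) (f i) (g i)) ⟩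
    sumBelow (suc n) (λ i → f i * h (n ∸ i) + g i * h (n ∸ i)) ≡⟨ sumBelow-+ (suc n) (λ i → f i * h (n ∸ i)) (λ i → g i * h (n ∸ i)) ⟩
    sumBelow (suc n) (λ i → f i * h (n ∸ i)) + sumBelow (suc n) (λ i → g i * h (n ∸ i))
                                                  ≡⟨ cong₂ _+_ (⊛-sumBelow f h n) (⊛-sumBelow g h n) ⟨
    (f ⊛ h) n + (g ⊛ h) n                         ∎

  ⊛-scalarˡ : ∀ c f h n → ((λ m → c * f m) ⊛ h) n ≡ c * (f ⊛ h) n
  ⊛-scalarˡ c f h n = begin
    ((λ m → c * f m) ⊛ h) n                       ≡⟨ ⊛-sumBelow (λ m → c * f m) h n ⟩
    sumBelow (suc n) (λ i → c * f i * h (n ∸ i))   ≡⟨ sumBelow-cong (suc n) {λ i → c * f i * h (n ∸ i)} (λ i _ → ℤP.*-assoc c (f i) _) ⟩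
    sumBelow (suc n) (λ i → c * (f i * h (n ∸ i))) ≡⟨ sumBelow-*ˡ (suc n) c (λ i → f i * h (n ∸ i)) ⟩
    c * sumBelow (suc n) (λ i → f i * h (n ∸ i))   ≡⟨ cong (c *_) (⊛-sumBelow f h n) ⟨
    c * (f ⊛ h) n                                 ∎

  ⊛-zeroˡ : ∀ h → (𝟘 ⊛ h) ≈ 𝟘
  ⊛-zeroˡ h n = trans (⊛-sumBelow 𝟘 h n) (sumBelow-zero (suc n) _ (λ i → ℤP.*-zeroˡ (h (n ∸ i))))

  ⊛-identityˡ : ∀ h → (𝟙 ⊛ h) ≈ h
  ⊛-identityˡ h zero = trans (⊛-zero 𝟙 h) (ℤP.*-identityˡ (h 0))
  ⊛-identityˡ h (suc n) = begin
    (𝟙 ⊛ h) (suc n)                      ≡⟨ ⊛-suc 𝟙 h n ⟩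
    + 1 * h (suc n) + (𝟘 ⊛ h) n           ≡⟨ cong₂ _+_ (ℤP.*-identityˡ (h (suc n))) (⊛-zeroˡ h n) ⟩
    h (suc n) + + 0                      ≡⟨ ℤP.+-identityʳ _ ⟩
    h (suc n)                            ∎

  -- Induction on n, peeling the constant term of f: tail (f ⊛ g) = f 0 · tail g + tail f ⊛ g.
  ⊛-assoc : ∀ f g h → ((f ⊛ g) ⊛ h) ≈ (f ⊛ (g ⊛ h))
  ⊛-assoc f g h zero = begin
    ((f ⊛ g) ⊛ h) 0     ≡⟨ trans (⊛-zero (f ⊛ g) h) (cong (_* h 0) (⊛-zero f g)) ⟩
    f 0 * g 0 * h 0     ≡⟨ ℤP.*-assoc (f 0) (g 0) (h 0) ⟩
    f 0 * (g 0 * h 0)   ≡⟨ trans (⊛-zero f (g ⊛ h)) (cong (f 0 *_) (⊛-zero g h)) ⟨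
    (f ⊛ (g ⊛ h)) 0     ∎
  ⊛-assoc f g h (suc n) = begin
    ((f ⊛ g) ⊛ h) (suc n)
      ≡⟨ ⊛-suc (f ⊛ g) h n ⟩
    (f ⊛ g) 0 * h (suc n) + (tail (f ⊛ g) ⊛ h) n
      ≡⟨ cong₂ _+_ (cong (_* h (suc n)) (⊛-zero f g)) (⊛-cong {g = h} {g′ = h} (⊛-suc f g) (λ _ → refl) n) ⟩
    f 0 * g 0 * h (suc n) + ((λ m → f 0 * tail g m + (tail f ⊛ g) m) ⊛ h) n
      ≡⟨ cong (_+_ (f 0 * g 0 * h (suc n))) (⊛-distribʳ (λ m → f 0 * tail g m) (tail f ⊛ g) h n) ⟩
    f 0 * g 0 * h (suc n) + (((λ m → f 0 * tail g m) ⊛ h) n + ((tail f ⊛ g) ⊛ h) n)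
      ≡⟨ cong (λ x → f 0 * g 0 * h (suc n) + x) (cong₂ _+_ (⊛-scalarˡ (f 0) (tail g) h n) (⊛-assoc (tail f) g h n)) ⟩
    f 0 * g 0 * h (suc n) + (f 0 * (tail g ⊛ h) n + (tail f ⊛ (g ⊛ h)) n)
      ≡⟨ regroup (f 0) (g 0) (h (suc n)) _ _ ⟩
    f 0 * (g 0 * h (suc n) + (tail g ⊛ h) n) + (tail f ⊛ (g ⊛ h)) n
      ≡⟨ cong (λ x → f 0 * x + (tail f ⊛ (g ⊛ h)) n) (⊛-suc g h n) ⟨
    f 0 * (g ⊛ h) (suc n) + (tail f ⊛ (g ⊛ h)) n
      ≡⟨ ⊛-suc f (g ⊛ h) n ⟨
    (f ⊛ (g ⊛ h)) (suc n) ∎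
    where
    regroup : ∀ a b c d e → a * b * c + (a * d + e) ≡ a * (b * c + d) + e
    regroup = solveℤ

-- Series as a commutative ring

infixl 6 _⊕_
infixl 7 _⊗_

-- Opaque, so that the ring solver treats sums and products as atoms.
opaque
  _⊕_ : Series → Series → Series
  (f ⊕ g) n = f n + g n

  ⊝ : Series → Series
  ⊝ f n = - f n

  _⊗_ : Series → Series → Series
  _⊗_ = _⊛_

  ⊕-def : ∀ f g n → (f ⊕ g) n ≡ f n + g n
  ⊕-def f g n = refl

  ⊝-def : ∀ f n → ⊝ f n ≡ - f n
  ⊝-def f n = refl

  ⊗-def : ∀ f g n → (f ⊗ g) n ≡ (f ⊛ g) n
  ⊗-def f g n = refl

module _ where
  open ≡-Reasoning

  ≈-isEquivalence : IsEquivalence _≈_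
  ≈-isEquivalence = record
    { refl = λ n → refl ; sym = λ e n → sym (e n) ; trans = λ e e′ n → trans (e n) (e′ n) }

  SeriesSetoid : Setoid 0ℓ 0ℓ
  SeriesSetoid = record { isEquivalence = ≈-isEquivalence }

  open IsEquivalence ≈-isEquivalence public
    using () renaming (refl to ≈-refl; sym to ≈-sym; trans to ≈-trans)

  ⊕-cong[] : ∀ {f f′ g g′ K} → f ≈[ K ] f′ → g ≈[ K ] g′ → (f ⊕ g) ≈[ K ] (f′ ⊕ g′)
  ⊕-cong[] {f} {f′} {g} {g′} ef eg n p =
    trans (⊕-def f g n) (trans (cong₂ _+_ (ef n p) (eg n p)) (sym (⊕-def f′ g′ n)))

  ⊕-cong : ∀ {f f′ g g′} → f ≈ f′ → g ≈ g′ → (f ⊕ g) ≈ (f′ ⊕ g′)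
  ⊕-cong ef eg n = ⊕-cong[] (λ m _ → ef m) (λ m _ → eg m) n ℕP.≤-refl

  ⊝-cong : ∀ {f f′} → f ≈ f′ → ⊝ f ≈ ⊝ f′
  ⊝-cong {f} {f′} e n = trans (⊝-def f n) (trans (cong -_ (e n)) (sym (⊝-def f′ n)))

  ⊗-cong[] : ∀ {f f′ g g′} K → f ≈[ K ] f′ → g ≈[ K ] g′ → (f ⊗ g) ≈[ K ] (f′ ⊗ g′)
  ⊗-cong[] {f} {f′} {g} {g′} K ef eg n p =
    trans (⊗-def f g n) (trans (⊛-cong[] K ef eg n p) (sym (⊗-def f′ g′ n)))

  ⊗-cong : ∀ {f f′ g g′} → f ≈ f′ → g ≈ g′ → (f ⊗ g) ≈ (f′ ⊗ g′)
  ⊗-cong ef eg n = ⊗-cong[] (suc n) (λ m _ → ef m) (λ m _ → eg m) n ℕP.≤-refl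

  ⊗-congˡ : ∀ h {f g} → f ≈ g → (h ⊗ f) ≈ (h ⊗ g)
  ⊗-congˡ h = ⊗-cong ≈-refl

  ⊗-congʳ : ∀ h {f g} → f ≈ g → (f ⊗ h) ≈ (g ⊗ h)
  ⊗-congʳ h e = ⊗-cong e ≈-refl

  ⊗-cong[]ˡ : ∀ {f g} h K → f ≈[ K ] g → (h ⊗ f) ≈[ K ] (h ⊗ g)
  ⊗-cong[]ˡ h K = ⊗-cong[] K (λ _ _ → refl)

  ⊗-cong[]ʳ : ∀ {f g} h K → f ≈[ K ] g → (f ⊗ h) ≈[ K ] (g ⊗ h)
  ⊗-cong[]ʳ h K e = ⊗-cong[] K e (λ _ _ → refl)

  ⊕-assoc : ∀ f g h → ((f ⊕ g) ⊕ h) ≈ (f ⊕ (g ⊕ h))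
  ⊕-assoc f g h n = begin
    ((f ⊕ g) ⊕ h) n   ≡⟨ trans (⊕-def (f ⊕ g) h n) (cong (_+ h n) (⊕-def f g n)) ⟩
    f n + g n + h n   ≡⟨ ℤP.+-assoc (f n) (g n) (h n) ⟩
    f n + (g n + h n) ≡⟨ trans (⊕-def f (g ⊕ h) n) (cong (_+_ (f n)) (⊕-def g h n)) ⟨
    (f ⊕ (g ⊕ h)) n   ∎

  ⊕-comm : ∀ f g → (f ⊕ g) ≈ (g ⊕ f)
  ⊕-comm f g n = trans (⊕-def f g n) (trans (ℤP.+-comm (f n) (g n)) (sym (⊕-def g f n)))

  ⊕-identityˡ : ∀ f → (𝟘 ⊕ f) ≈ f
  ⊕-identityˡ f n = trans (⊕-def 𝟘 f n) (ℤP.+-identityˡ (f n))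

  ⊕-identityʳ : ∀ f → (f ⊕ 𝟘) ≈ f
  ⊕-identityʳ f n = trans (⊕-def f 𝟘 n) (ℤP.+-identityʳ (f n))

  ⊕-inverseˡ : ∀ f → (⊝ f ⊕ f) ≈ 𝟘
  ⊕-inverseˡ f n = trans (⊕-def (⊝ f) f n) (trans (cong (_+ f n) (⊝-def f n)) (ℤP.+-inverseˡ (f n)))

  ⊕-inverseʳ : ∀ f → (f ⊕ ⊝ f) ≈ 𝟘
  ⊕-inverseʳ f n = trans (⊕-def f (⊝ f) n) (trans (cong (_+_ (f n)) (⊝-def f n)) (ℤP.+-inverseʳ (f n)))

  ⊗-assoc : ∀ f g h → ((f ⊗ g) ⊗ h) ≈ (f ⊗ (g ⊗ h))
  ⊗-assoc f g h n = begin
    ((f ⊗ g) ⊗ h) n ≡⟨ trans (⊗-def (f ⊗ g) h n) (⊛-cong {g = h} {g′ = h} (⊗-def f g) ≈-refl n) ⟩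
    ((f ⊛ g) ⊛ h) n ≡⟨ ⊛-assoc f g h n ⟩
    (f ⊛ (g ⊛ h)) n ≡⟨ trans (⊗-def f (g ⊗ h) n) (⊛-cong {f = f} {f′ = f} ≈-refl (⊗-def g h) n) ⟨
    (f ⊗ (g ⊗ h)) n ∎

  ⊗-comm : ∀ f g → (f ⊗ g) ≈ (g ⊗ f)
  ⊗-comm f g n = trans (⊗-def f g n) (trans (⊛-comm f g n) (sym (⊗-def g f n)))

  ⊗-identityˡ : ∀ h → (𝟙 ⊗ h) ≈ h
  ⊗-identityˡ h n = trans (⊗-def 𝟙 h n) (⊛-identityˡ h n)

  ⊗-identityʳ : ∀ h → (h ⊗ 𝟙) ≈ h
  ⊗-identityʳ h n = trans (⊗-comm h 𝟙 n) (⊗-identityˡ h n)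

  ⊗-zeroˡ : ∀ h → (𝟘 ⊗ h) ≈ 𝟘
  ⊗-zeroˡ h n = trans (⊗-def 𝟘 h n) (⊛-zeroˡ h n)

  ⊗-zeroʳ : ∀ h → (h ⊗ 𝟘) ≈ 𝟘
  ⊗-zeroʳ h n = trans (⊗-comm h 𝟘 n) (⊗-zeroˡ h n)

  ⊗-distribʳ : ∀ h f g → ((f ⊕ g) ⊗ h) ≈ (f ⊗ h ⊕ g ⊗ h)
  ⊗-distribʳ h f g n = begin
    ((f ⊕ g) ⊗ h) n               ≡⟨ trans (⊗-def (f ⊕ g) h n) (⊛-cong {g = h} {g′ = h} (⊕-def f g) ≈-refl n) ⟩
    ((λ m → f m + g m) ⊛ h) n     ≡⟨ ⊛-distribʳ f g h n ⟩
    (f ⊛ h) n + (g ⊛ h) n         ≡⟨ cong₂ _+_ (⊗-def f h n) (⊗-def g h n) ⟨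
    (f ⊗ h) n + (g ⊗ h) n         ≡⟨ ⊕-def (f ⊗ h) (g ⊗ h) n ⟨
    (f ⊗ h ⊕ g ⊗ h) n             ∎

  ⊗-distribˡ : ∀ h f g → (h ⊗ (f ⊕ g)) ≈ (h ⊗ f ⊕ h ⊗ g)
  ⊗-distribˡ h f g n = begin
    (h ⊗ (f ⊕ g)) n     ≡⟨ ⊗-comm h (f ⊕ g) n ⟩
    ((f ⊕ g) ⊗ h) n     ≡⟨ ⊗-distribʳ h f g n ⟩
    (f ⊗ h ⊕ g ⊗ h) n   ≡⟨ ⊕-cong (⊗-comm f h) (⊗-comm g h) n ⟩
    (h ⊗ f ⊕ h ⊗ g) n   ∎

≈⇒≈[] : ∀ {f g} K → f ≈ g → f ≈[ K ] g
≈⇒≈[] K e n _ = e n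

≈[]-trans : ∀ {f g h K} → f ≈[ K ] g → g ≈[ K ] h → f ≈[ K ] h
≈[]-trans e e′ n p = trans (e n p) (e′ n p)

≈[]-sym : ∀ {f g K} → f ≈[ K ] g → g ≈[ K ] f
≈[]-sym e n p = sym (e n p)

≈[]-mono : ∀ {f g K K′} → K′ ℕ.≤ K → f ≈[ K ] g → f ≈[ K′ ] g
≈[]-mono K′≤K e n p = e n (ℕP.<-≤-trans p K′≤K)

⊗-zeroʳ′ : ∀ h {f} → f ≈ 𝟘 → (h ⊗ f) ≈ 𝟘
⊗-zeroʳ′ h f≈0 = ≈-trans (⊗-congˡ h f≈0) (⊗-zeroʳ h)

Series-isCommutativeRing : IsCommutativeRing _≈_ _⊕_ _⊗_ ⊝ 𝟘 𝟙
Series-isCommutativeRing = record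
  { isRing = record
    { +-isAbelianGroup = record
      { isGroup = record
        { isMonoid = record
          { isSemigroup = record
            { isMagma = record { isEquivalence = ≈-isEquivalence ; ∙-cong = ⊕-cong }
            ; assoc = ⊕-assoc }
          ; identity = ⊕-identityˡ , ⊕-identityʳ }
        ; inverse = ⊕-inverseˡ , ⊕-inverseʳ
        ; ⁻¹-cong = ⊝-cong }
      ; comm = ⊕-comm }
    ; *-cong = ⊗-cong
    ; *-assoc = ⊗-assoc
    ; *-identity = ⊗-identityˡ , ⊗-identityʳ
    ; distrib = ⊗-distribˡ , ⊗-distribʳ }
  ; *-comm = ⊗-comm }

SeriesRing : CommutativeRing 0ℓ 0ℓ
SeriesRing = record { isCommutativeRing = Series-isCommutativeRing }

module SeriesSolver where
  open import Data.Integer using (_*_)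

  ι : ℤ → Series
  ι c n = c * 𝟙 n

  ι-homomorphism : ACR._-Raw-AlmostCommutative⟶_ (CommutativeRing.rawRing ℤP.+-*-commutativeRing)
                     (ACR.fromCommutativeRing SeriesRing)
  ι-homomorphism = record
    { ⟦_⟧ = ι
    ; +-homo = λ a b n → trans (ℤP.*-distribʳ-+ (𝟙 n) a b) (sym (⊕-def (ι a) (ι b) n))
    ; *-homo = λ a b n → trans (ℤP.*-assoc a b (𝟙 n)) (trans (cong (a *_) (sym (⊛-identityˡ (ι b) n)))
                 (trans (sym (⊛-scalarˡ a 𝟙 (ι b) n)) (sym (⊗-def (ι a) (ι b) n))))
    ; -‿homo = λ a n → trans (sym (ℤP.neg-distribˡ-* a (𝟙 n))) (sym (⊝-def (ι a) n))
    ; 0-homo = λ n → ℤP.*-zeroˡ (𝟙 n)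
    ; 1-homo = λ n → ℤP.*-identityˡ (𝟙 n)
    }

  ι-equal? : ∀ a b → Maybe (ι a ≈ ι b)
  ι-equal? a b with a ℤ.≟ b
  ... | yes refl = just ≈-refl
  ... | no _ = nothing

  open Algebra.Solver.Ring _ (ACR.fromCommutativeRing SeriesRing) ι-homomorphism ι-equal? public
    using (solve; _:=_; _:+_; _:*_; :-_; con)

  ι1 : ι (+ 1) ≈ 𝟙
  ι1 n = ℤP.*-identityˡ (𝟙 n)

q^ : ℕ → Series
q^ zero = 𝟙
q^ (suc j) zero = + 0
q^ (suc j) (suc n) = q^ j n

shift : ℕ → Series → Series
shift zero g = g
shift (suc j) g zero = + 0
shift (suc j) g (suc n) = shift j g n

q^⊗ : ∀ j g → (q^ j ⊗ g) ≈ shift j g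
q^⊗ j g n = trans (⊗-def (q^ j) g n) (q^⊛ j n)
  where
  q^⊛ : ∀ j → (q^ j ⊛ g) ≈ shift j g
  q^⊛ zero = ⊛-identityˡ g
  q^⊛ (suc j) zero = ⊛-zero (q^ (suc j)) g
  q^⊛ (suc j) (suc n) = begin
    (q^ (suc j) ⊛ g) (suc n)               ≡⟨ ⊛-suc (q^ (suc j)) g n ⟩
    + 0 ℤ.* g (suc n) + (q^ j ⊛ g) n        ≡⟨ ℤP.+-identityˡ _ ⟩
    (q^ j ⊛ g) n                           ≡⟨ q^⊛ j n ⟩
    shift j g n                            ∎
    where open ≡-Reasoning

shift-q^ : ∀ a b → shift a (q^ b) ≈ q^ (a ℕ.+ b)
shift-q^ zero b n = refl
shift-q^ (suc a) b zero = refl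
shift-q^ (suc a) b (suc n) = shift-q^ a b n

q^-+ : ∀ a b → (q^ a ⊗ q^ b) ≈ q^ (a ℕ.+ b)
q^-+ a b n = trans (q^⊗ a (q^ b) n) (shift-q^ a b n)

q^-cong : ∀ {a b} → a ≡ b → q^ a ≈ q^ b
q^-cong refl = ≈-refl

shift-≤ᵇ : ∀ j g n → shift j g n ≡ (if j ≤ᵇ n then g (n ∸ j) else + 0)
shift-≤ᵇ zero g n = refl
shift-≤ᵇ (suc j) g zero = refl
shift-≤ᵇ (suc zero) g (suc n) = refl
shift-≤ᵇ (suc (suc j)) g (suc n) = shift-≤ᵇ (suc j) g n

shift-below : ∀ j g n → n ℕ.< j → shift j g n ≡ + 0
shift-below (suc j) g zero p = refl
shift-below (suc j) g (suc n) (s≤s p) = shift-below j g n p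

shift-above : ∀ j g n → j ℕ.≤ n → shift j g n ≡ g (n ∸ j)
shift-above zero g n _ = refl
shift-above (suc j) g (suc n) (s≤s j≤n) = shift-above j g n j≤n

shift-cong[] : ∀ {f g} j K → f ≈[ K ∸ j ] g → shift j f ≈[ K ] shift j g
shift-cong[] zero K e = e
shift-cong[] (suc j) K e zero p = refl
shift-cong[] (suc j) (suc K) e (suc n) (s≤s p) = shift-cong[] j K e n p

q^⊗-cong[] : ∀ {f g} j K → f ≈[ K ∸ j ] g → (q^ j ⊗ f) ≈[ K ] (q^ j ⊗ g)
q^⊗-cong[] {f} {g} j K e n p = trans (q^⊗ j f n) (trans (shift-cong[] j K e n p) (sym (q^⊗ j g n)))

q^⊗-below : ∀ j g K → K ℕ.≤ j → (q^ j ⊗ g) ≈[ K ] 𝟘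
q^⊗-below j g K K≤j n n<K = trans (q^⊗ j g n) (shift-below j g n (ℕP.<-≤-trans n<K K≤j))

q^-below : ∀ j K → K ℕ.≤ j → q^ j ≈[ K ] 𝟘
q^-below j K K≤j n n<K = trans (sym (⊗-identityʳ (q^ j) n)) (q^⊗-below j 𝟙 K K≤j n n<K)

open SeriesSolver
private module ≈-Reasoning = SetoidReasoning SeriesSetoid

-- Gaussian binomial coefficients

qBinom : ℕ → ℕ → Series
qBinom m zero = 𝟙
qBinom zero (suc k) = 𝟘
qBinom (suc m) (suc k) = qBinom m k ⊕ q^ (suc k) ⊗ qBinom m (suc k)

qBinom-vanish : ∀ m k → m ℕ.< k → qBinom m k ≈ 𝟘
qBinom-vanish zero (suc k) _ = ≈-refl
qBinom-vanish (suc m) (suc k) (s≤s m<k) = begin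
  qBinom m k ⊕ q^ (suc k) ⊗ qBinom m (suc k)
    ≈⟨ ⊕-cong (qBinom-vanish m k m<k) (⊗-zeroʳ′ (q^ (suc k)) (qBinom-vanish m (suc k) (ℕP.m≤n⇒m≤1+n m<k))) ⟩
  𝟘 ⊕ 𝟘 ≈⟨ ⊕-identityˡ 𝟘 ⟩
  𝟘 ∎
  where open ≈-Reasoning

q^⊗qBinom-vanish : ∀ j m k → m ℕ.< k → (q^ j ⊗ qBinom m k) ≈ 𝟘
q^⊗qBinom-vanish j m k m<k = ⊗-zeroʳ′ (q^ j) (qBinom-vanish m k m<k)

q^⊗qBinom-cong : ∀ M k {x y} → (k ℕ.≤ M → x ≡ y) → (q^ x ⊗ qBinom M k) ≈ (q^ y ⊗ qBinom M k)
q^⊗qBinom-cong M k {x} {y} x≡y with k ℕP.≤? M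
... | yes k≤M = ⊗-congʳ (qBinom M k) (q^-cong (x≡y k≤M))
... | no k≰M = ≈-trans (q^⊗qBinom-vanish x M k (ℕP.≰⇒> k≰M)) (≈-sym (q^⊗qBinom-vanish y M k (ℕP.≰⇒> k≰M)))

qBinom-pascal′-≤ : ∀ m k → k ℕ.≤ m → qBinom (suc m) (suc k) ≈ (q^ (m ∸ k) ⊗ qBinom m k ⊕ qBinom m (suc k))
qBinom-pascal′-≤ zero zero _ = begin
  𝟙 ⊕ q^ 1 ⊗ 𝟘 ≈⟨ ⊕-cong (≈-sym (⊗-identityˡ 𝟙)) (⊗-zeroʳ (q^ 1)) ⟩
  𝟙 ⊗ 𝟙 ⊕ 𝟘 ∎
  where open ≈-Reasoning
qBinom-pascal′-≤ (suc m) zero _ = begin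
  𝟙 ⊕ q^ 1 ⊗ qBinom (suc m) 1
    ≈⟨ ⊕-cong ≈-refl (⊗-congˡ (q^ 1) (qBinom-pascal′-≤ m zero z≤n)) ⟩
  𝟙 ⊕ q^ 1 ⊗ (q^ m ⊗ 𝟙 ⊕ qBinom m 1)
    ≈⟨ expand (q^ 1) (q^ m) (qBinom m 1) ⟩
  (q^ 1 ⊗ q^ m) ⊗ 𝟙 ⊕ (𝟙 ⊕ q^ 1 ⊗ qBinom m 1)
    ≈⟨ ⊕-cong (⊗-congʳ 𝟙 (q^-+ 1 m)) ≈-refl ⟩
  q^ (suc m) ⊗ 𝟙 ⊕ qBinom (suc m) 1 ∎
  where
  open ≈-Reasoning
  expand : ∀ x y z → (𝟙 ⊕ x ⊗ (y ⊗ 𝟙 ⊕ z)) ≈ ((x ⊗ y) ⊗ 𝟙 ⊕ (𝟙 ⊕ x ⊗ z))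
  expand x y z = begin
    𝟙 ⊕ x ⊗ (y ⊗ 𝟙 ⊕ z)
      ≈⟨ ⊕-cong ι1 (⊗-congˡ x (⊕-cong (⊗-congˡ y ι1) ≈-refl)) ⟨
    ι (+ 1) ⊕ x ⊗ (y ⊗ ι (+ 1) ⊕ z)
      ≈⟨ solve 3 (λ x y z → con (+ 1) :+ x :* (y :* con (+ 1) :+ z)
                           := (x :* y) :* con (+ 1) :+ (con (+ 1) :+ x :* z)) ≈-refl x y z ⟩
    (x ⊗ y) ⊗ ι (+ 1) ⊕ (ι (+ 1) ⊕ x ⊗ z)
      ≈⟨ ⊕-cong (⊗-congˡ (x ⊗ y) ι1) (⊕-cong ι1 ≈-refl) ⟩
    (x ⊗ y) ⊗ 𝟙 ⊕ (𝟙 ⊕ x ⊗ z) ∎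
qBinom-pascal′-≤ (suc m) (suc k) (s≤s k≤m) with ℕP.m≤n⇒m<n∨m≡n k≤m
... | inj₁ k<m = begin
  qBinom (suc m) (suc k) ⊕ z ⊗ qBinom (suc m) (suc (suc k))
    ≈⟨ ⊕-cong (qBinom-pascal′-≤ m k k≤m) (⊗-congˡ z (qBinom-pascal′-≤ m (suc k) k<m)) ⟩
  (x ⊗ A ⊕ C) ⊕ z ⊗ (w ⊗ C ⊕ D)
    ≈⟨ solve 6 (λ A C D x z w → (x :* A :+ C) :+ z :* (w :* C :+ D)
                              := x :* A :+ C :+ (z :* w) :* C :+ z :* D) ≈-refl A C D x z w ⟩
  x ⊗ A ⊕ C ⊕ (z ⊗ w) ⊗ C ⊕ z ⊗ D
    ≈⟨ ⊕-cong (⊕-cong ≈-refl (⊗-congʳ C zw≈xy)) ≈-refl ⟩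
  x ⊗ A ⊕ C ⊕ (x ⊗ y) ⊗ C ⊕ z ⊗ D
    ≈⟨ solve 6 (λ A C D x y z → x :* A :+ C :+ (x :* y) :* C :+ z :* D
                              := x :* (A :+ y :* C) :+ (C :+ z :* D)) ≈-refl A C D x y z ⟩
  x ⊗ (A ⊕ y ⊗ C) ⊕ (C ⊕ z ⊗ D) ∎
  where
  open ≈-Reasoning
  A = qBinom m k
  C = qBinom m (suc k)
  D = qBinom m (suc (suc k))
  x = q^ (m ∸ k)
  y = q^ (suc k)
  z = q^ (suc (suc k))
  w = q^ (m ∸ suc k)
  exponent : suc (suc k) ℕ.+ (m ∸ suc k) ≡ (m ∸ k) ℕ.+ suc k
  exponent = trans (cong suc (ℕP.m+[n∸m]≡n k<m)) (sym (trans (ℕP.+-suc (m ∸ k) k) (cong suc (ℕP.m∸n+n≡m k≤m))))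
  zw≈xy : (z ⊗ w) ≈ (x ⊗ y)
  zw≈xy = ≈-trans (q^-+ (suc (suc k)) (m ∸ suc k)) (≈-trans (q^-cong exponent) (≈-sym (q^-+ (m ∸ k) (suc k))))
... | inj₂ refl = begin
  qBinom (suc m) (suc m) ⊕ q^ (suc (suc m)) ⊗ qBinom (suc m) (suc (suc m))
    ≈⟨ ⊕-cong (≈-sym (⊗-identityˡ _)) (q^⊗qBinom-vanish (suc (suc m)) (suc m) (suc (suc m)) ℕP.≤-refl) ⟩
  𝟙 ⊗ qBinom (suc m) (suc m) ⊕ 𝟘
    ≈⟨ ⊕-cong (⊗-congʳ _ (q^-cong (sym (ℕP.n∸n≡0 m)))) (≈-sym (qBinom-vanish (suc m) (suc (suc m)) ℕP.≤-refl)) ⟩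
  q^ (m ∸ m) ⊗ qBinom (suc m) (suc m) ⊕ qBinom (suc m) (suc (suc m)) ∎
  where open ≈-Reasoning

qBinom-pascal′ : ∀ m k → qBinom (suc m) (suc k) ≈ (q^ (m ∸ k) ⊗ qBinom m k ⊕ qBinom m (suc k))
qBinom-pascal′ m k with k ℕP.≤? m
... | yes k≤m = qBinom-pascal′-≤ m k k≤m
... | no k≰m = begin
  qBinom (suc m) (suc k) ≈⟨ qBinom-vanish (suc m) (suc k) (s≤s m<k) ⟩
  𝟘                      ≈⟨ ⊕-identityʳ 𝟘 ⟨
  𝟘 ⊕ 𝟘                  ≈⟨ ⊕-cong (q^⊗qBinom-vanish (m ∸ k) m k m<k) (qBinom-vanish m (suc k) (ℕP.m≤n⇒m≤1+n m<k)) ⟨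
  q^ (m ∸ k) ⊗ qBinom m k ⊕ qBinom m (suc k) ∎
  where
  open ≈-Reasoning
  m<k = ℕP.≰⇒> k≰m

-- Truncations of the Euler product

oneMinusQ^-≈ : ∀ m → oneMinusQ^ (suc m) ≈ (𝟙 ⊕ ⊝ (q^ (suc m)))
oneMinusQ^-≈ m zero = sym (trans (⊕-def 𝟙 (⊝ (q^ (suc m))) 0) (cong (_+_ (+ 1)) (⊝-def (q^ (suc m)) 0)))
oneMinusQ^-≈ m (suc j) = trans (coefficient j) (sym (trans (⊕-def 𝟙 _ (suc j))
                            (trans (cong (_+_ (+ 0)) (⊝-def (q^ (suc m)) (suc j))) (ℤP.+-identityˡ _))))
  where
  q^-diagonal : ∀ m → q^ m m ≡ + 1
  q^-diagonal zero = refl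
  q^-diagonal (suc m) = q^-diagonal m
  q^-off-diagonal : ∀ m j → j ≢ m → q^ m j ≡ + 0
  q^-off-diagonal zero zero j≢m = ⊥-elim (j≢m refl)
  q^-off-diagonal zero (suc j) _ = refl
  q^-off-diagonal (suc m) zero _ = refl
  q^-off-diagonal (suc m) (suc j) j≢m = q^-off-diagonal m j (j≢m ∘ cong suc)
  coefficient : ∀ j → oneMinusQ^ (suc m) (suc j) ≡ - q^ m j
  coefficient j with suc j ℕ.≟ suc m
  ... | yes sj≡sm = cong -_ (sym (trans (cong (q^ m) (ℕP.suc-injective sj≡sm)) (q^-diagonal m)))
  ... | no sj≢sm = sym (cong -_ (q^-off-diagonal m j (sj≢sm ∘ cong suc)))

eulerPartial-suc : ∀ m → eulerPartial (suc m) ≈ (eulerPartial m ⊗ (𝟙 ⊕ ⊝ (q^ (suc m))))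
eulerPartial-suc m n = trans (⊛-cong {eulerPartial m} {eulerPartial m} ≈-refl (oneMinusQ^-≈ m) n)
                         (sym (⊗-def (eulerPartial m) _ n))

⊗-one-minus : ∀ x X → (X ⊗ (𝟙 ⊕ ⊝ x)) ≈ (X ⊕ ⊝ (x ⊗ X))
⊗-one-minus x X = begin
  X ⊗ (𝟙 ⊕ ⊝ x)                 ≈⟨ ⊗-congˡ X (⊕-cong ι1 ≈-refl) ⟨
  X ⊗ (ι (+ 1) ⊕ ⊝ x)           ≈⟨ solve 2 (λ x X → X :* (con (+ 1) :+ :- x) := X :* con (+ 1) :+ :- (x :* X)) ≈-refl x X ⟩
  X ⊗ ι (+ 1) ⊕ ⊝ (x ⊗ X)       ≈⟨ ⊕-cong (≈-trans (⊗-congˡ X ι1) (⊗-identityʳ X)) ≈-refl ⟩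
  X ⊕ ⊝ (x ⊗ X)                 ∎
  where open ≈-Reasoning

⊕-q^⊗-below : ∀ X Y j K → K ℕ.≤ j → (X ⊕ q^ j ⊗ Y) ≈[ K ] X
⊕-q^⊗-below X Y j K K≤j n n<K =
  trans (⊕-def X _ n) (trans (cong (_+_ (X n)) (q^⊗-below j Y K K≤j n n<K)) (ℤP.+-identityʳ (X n)))

⊕⊝-q^⊗-below : ∀ X Y j K → K ℕ.≤ j → (X ⊕ ⊝ (q^ j ⊗ Y)) ≈[ K ] X
⊕⊝-q^⊗-below X Y j K K≤j n n<K = trans (⊕-def X _ n)
  (trans (cong (_+_ (X n)) (trans (⊝-def _ n) (cong -_ (q^⊗-below j Y K K≤j n n<K)))) (ℤP.+-identityʳ (X n)))

eulerPartial-stable : ∀ m d → eulerPartial (d ℕ.+ m) ≈[ suc m ] eulerPartial m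
eulerPartial-stable m zero = λ _ _ → refl
eulerPartial-stable m (suc d) = ≈[]-trans (≈[]-mono (s≤s (ℕP.m≤n+m m d)) step) (eulerPartial-stable m d)
  where
  E = eulerPartial (d ℕ.+ m)
  step : eulerPartial (suc (d ℕ.+ m)) ≈[ suc (d ℕ.+ m) ] E
  step = ≈[]-trans (≈⇒≈[] _ (≈-trans (eulerPartial-suc (d ℕ.+ m)) (⊗-one-minus (q^ (suc (d ℕ.+ m))) E)))
                   (⊕⊝-q^⊗-below E E (suc (d ℕ.+ m)) _ ℕP.≤-refl)

qPochInf-truncation : ∀ j → qPochInf ≈[ suc j ] eulerPartial j
qPochInf-truncation j n (s≤s n≤j) =
  sym (trans (cong (λ t → eulerPartial t n) (sym (ℕP.m∸n+n≡m n≤j))) (eulerPartial-stable n (j ∸ n) n ℕP.≤-refl))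

-- (q;q)_j [M j] = (q;q)_M / (q;q)_{M-j} ≡ 1 modulo q^(M-j+1).
eulerPartial⊗qBinom : ∀ M j → j ℕ.≤ M → (eulerPartial j ⊗ qBinom M j) ≈[ suc (M ∸ j) ] 𝟙
eulerPartial⊗qBinom M zero _ = ≈⇒≈[] _ (⊗-identityˡ 𝟙)
eulerPartial⊗qBinom (suc M) (suc j) (s≤s j≤M) =
  ≈[]-trans (≈⇒≈[] K expand)
  (≈[]-trans (⊕-cong[] (⊗-cong[]ʳ (𝟙 ⊕ ⊝ x) K (eulerPartial⊗qBinom M j j≤M)) upper)
  (≈⇒≈[] K (telescope x)))
  where
  open ≈-Reasoning
  K = suc (M ∸ j)
  E = eulerPartial j
  E′ = eulerPartial (suc j)
  x = q^ (suc j)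
  P = qBinom M j
  Q = qBinom M (suc j)
  expand : (E′ ⊗ (P ⊕ x ⊗ Q)) ≈ ((E ⊗ P) ⊗ (𝟙 ⊕ ⊝ x) ⊕ x ⊗ (E′ ⊗ Q))
  expand = begin
    E′ ⊗ (P ⊕ x ⊗ Q)                                   ≈⟨ ⊗-congʳ _ (eulerPartial-suc j) ⟩
    (E ⊗ (𝟙 ⊕ ⊝ x)) ⊗ (P ⊕ x ⊗ Q)
      ≈⟨ solve 5 (λ E o x P Q → (E :* o) :* (P :+ x :* Q) := (E :* P) :* o :+ x :* ((E :* o) :* Q)) ≈-refl E (𝟙 ⊕ ⊝ x) x P Q ⟩
    (E ⊗ P) ⊗ (𝟙 ⊕ ⊝ x) ⊕ x ⊗ ((E ⊗ (𝟙 ⊕ ⊝ x)) ⊗ Q)    ≈⟨ ⊕-cong ≈-refl (⊗-congˡ x (⊗-congʳ Q (eulerPartial-suc j))) ⟨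
    (E ⊗ P) ⊗ (𝟙 ⊕ ⊝ x) ⊕ x ⊗ (E′ ⊗ Q)                 ∎
  upper : (x ⊗ (E′ ⊗ Q)) ≈[ K ] x
  upper with ℕP.m≤n⇒m<n∨m≡n j≤M
  ... | inj₁ j<M = ≈[]-trans (q^⊗-cong[] (suc j) K (≈[]-mono K∸sj≤ (eulerPartial⊗qBinom M (suc j) j<M)))
                             (≈⇒≈[] K (⊗-identityʳ x))
    where
    K∸sj≤ : K ∸ suc j ℕ.≤ suc (M ∸ suc j)
    K∸sj≤ = ℕP.≤-trans (ℕP.m∸n≤m (M ∸ j) j) (ℕP.≤-reflexive (ℕP.+-∸-assoc 1 j<M))
  ... | inj₂ refl = ≈[]-trans (≈⇒≈[] K (⊗-zeroʳ′ x (⊗-zeroʳ′ E′ (qBinom-vanish j (suc j) ℕP.≤-refl))))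
                             (≈[]-sym (q^-below (suc j) K (s≤s (subst (ℕ._≤ j) (sym (ℕP.n∸n≡0 j)) z≤n))))
  telescope : ∀ x → (𝟙 ⊗ (𝟙 ⊕ ⊝ x) ⊕ x) ≈ 𝟙
  telescope x = begin
    𝟙 ⊗ (𝟙 ⊕ ⊝ x) ⊕ x                   ≈⟨ ⊕-cong (⊗-cong ι1 (⊕-cong ι1 ≈-refl)) ≈-refl ⟨
    ι (+ 1) ⊗ (ι (+ 1) ⊕ ⊝ x) ⊕ x       ≈⟨ solve 1 (λ x → con (+ 1) :* (con (+ 1) :+ :- x) :+ x := con (+ 1)) ≈-refl x ⟩
    ι (+ 1)                             ≈⟨ ι1 ⟩
    𝟙                                   ∎

qPochInf⊗qBinom : ∀ M j K → j ℕ.≤ M → K ℕ.≤ suc (M ∸ j) → K ℕ.≤ suc j → (qPochInf ⊗ qBinom M j) ≈[ K ] 𝟙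
qPochInf⊗qBinom M j K j≤M K≤ K≤′ =
  ≈[]-trans (⊗-cong[]ʳ (qBinom M j) K (≈[]-mono K≤′ (qPochInf-truncation j))) (≈[]-mono K≤ (eulerPartial⊗qBinom M j j≤M))

-- Products of factors 1 + z^a q^b

-- Series in q whose coefficients are Laurent series in z: X α is the coefficient of z^α.
ZSeries : Set
ZSeries = ℤ → Series

infix 4 _≋_ _≋[_]_

_≋_ : ZSeries → ZSeries → Set
X ≋ Y = ∀ α → X α ≈ Y α

_≋[_]_ : ZSeries → ℕ → ZSeries → Set
X ≋[ K ] Y = ∀ α → X α ≈[ K ] Y α

≋-isEquivalence : IsEquivalence _≋_
≋-isEquivalence = record
  { refl = λ α n → refl ; sym = λ e α n → sym (e α n) ; trans = λ e e′ α n → trans (e α n) (e′ α n) }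

open IsEquivalence ≋-isEquivalence public
  using () renaming (refl to ≋-refl; sym to ≋-sym; trans to ≋-trans)

≋⇒≋[] : ∀ {X Y} K → X ≋ Y → X ≋[ K ] Y
≋⇒≋[] K e α n _ = e α n

≋[]-trans : ∀ {X Y Z K} → X ≋[ K ] Y → Y ≋[ K ] Z → X ≋[ K ] Z
≋[]-trans e e′ α n p = trans (e α n p) (e′ α n p)

𝟙ᶻ : ZSeries
𝟙ᶻ (+ zero) = 𝟙
𝟙ᶻ (+ suc _) = 𝟘
𝟙ᶻ -[1+ _ ] = 𝟘

mulFactor : Factor → ZSeries → ZSeries
mulFactor (a , b) X α = X α ⊕ q^ b ⊗ X (α - a)

mulFactors : List Factor → ZSeries → ZSeries
mulFactors [] X = X
mulFactors (f ∷ L) X = mulFactor f (mulFactors L X)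

prod : List Factor → ZSeries
prod L = mulFactors L 𝟙ᶻ

coeffProd≡prod : ∀ L α n → + coeffProd L α n ≡ prod L α n
coeffProd≡prod [] (+ zero) zero = refl
coeffProd≡prod [] (+ zero) (suc n) = refl
coeffProd≡prod [] (+ suc a) n = refl
coeffProd≡prod [] -[1+ a ] n = refl
coeffProd≡prod ((a , b) ∷ L) α n = begin
  + (coeffProd L α n ℕ.+ (if b ≤ᵇ n then coeffProd L (α - a) (n ∸ b) else 0))
    ≡⟨ ℤP.pos-+ (coeffProd L α n) _ ⟩
  + coeffProd L α n + + (if b ≤ᵇ n then coeffProd L (α - a) (n ∸ b) else 0)
    ≡⟨ cong₂ _+_ (coeffProd≡prod L α n) (shifted (b ≤ᵇ n) (shift-≤ᵇ b (prod L (α - a)) n)) ⟩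
  prod L α n + shift b (prod L (α - a)) n
    ≡⟨ cong (_+_ (prod L α n)) (q^⊗ b (prod L (α - a)) n) ⟨
  prod L α n + (q^ b ⊗ prod L (α - a)) n
    ≡⟨ ⊕-def (prod L α) _ n ⟨
  prod ((a , b) ∷ L) α n ∎
  where
  open ≡-Reasoning
  shifted : ∀ t → shift b (prod L (α - a)) n ≡ (if t then prod L (α - a) (n ∸ b) else + 0) →
            + (if t then coeffProd L (α - a) (n ∸ b) else 0) ≡ shift b (prod L (α - a)) n
  shifted true e = trans (coeffProd≡prod L (α - a) (n ∸ b)) (sym e)
  shifted false e = sym e

mulFactor-cong[] : ∀ f {X Y} K → X ≋[ K ] Y → mulFactor f X ≋[ K ] mulFactor f Y
mulFactor-cong[] (a , b) K e α = ⊕-cong[] (e α) (⊗-cong[]ˡ (q^ b) K (e (α - a)))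

mulFactors-cong[] : ∀ L {X Y} K → X ≋[ K ] Y → mulFactors L X ≋[ K ] mulFactors L Y
mulFactors-cong[] [] K e = e
mulFactors-cong[] (f ∷ L) K e = mulFactor-cong[] f K (mulFactors-cong[] L K e)

mulFactor-cong : ∀ f {X Y} → X ≋ Y → mulFactor f X ≋ mulFactor f Y
mulFactor-cong (a , b) e α = ⊕-cong (e α) (⊗-congˡ (q^ b) (e (α - a)))

mulFactors-cong : ∀ L {X Y} → X ≋ Y → mulFactors L X ≋ mulFactors L Y
mulFactors-cong [] e = e
mulFactors-cong (f ∷ L) e = mulFactor-cong f (mulFactors-cong L e)

ZSeries-at : ∀ (X : ZSeries) {α β} → α ≡ β → X α ≈ X β
ZSeries-at X refl = ≈-refl

mulFactor-comm : ∀ f g X → mulFactor f (mulFactor g X) ≋ mulFactor g (mulFactor f X)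
mulFactor-comm (a , b) (c , d) X α = ≈-trans
  (⊕-cong ≈-refl (⊗-congˡ (q^ b) (⊕-cong ≈-refl (⊗-congˡ (q^ d) (ZSeries-at X (swap α a c))))))
  (solve 6 (λ A C E W x y → A :+ y :* C :+ x :* (E :+ y :* W) := A :+ x :* E :+ y :* (C :+ x :* W)) ≈-refl
     (X α) (X (α - c)) (X (α - a)) (X (α - c - a)) (q^ b) (q^ d))
  where
  swap : ∀ α a c → α - a - c ≡ α - c - a
  swap = solveℤ

mulFactors-mulFactor : ∀ L f X → mulFactors L (mulFactor f X) ≋ mulFactor f (mulFactors L X)
mulFactors-mulFactor [] f X = ≋-refl
mulFactors-mulFactor (g ∷ L) f X = ≋-trans (mulFactor-cong g (mulFactors-mulFactor L f X)) (mulFactor-comm g f _)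

mulFactors-comm : ∀ L M X → mulFactors L (mulFactors M X) ≋ mulFactors M (mulFactors L X)
mulFactors-comm [] M X = ≋-refl
mulFactors-comm (f ∷ L) M X = ≋-trans (mulFactor-cong f (mulFactors-comm L M X)) (≋-sym (mulFactors-mulFactor M f _))

mulFactors-++ : ∀ L M X → mulFactors (L ++ M) X ≋ mulFactors L (mulFactors M X)
mulFactors-++ [] M X = ≋-refl
mulFactors-++ (f ∷ L) M X = mulFactor-cong f (mulFactors-++ L M X)

infixl 7 _·ᶻ_
_·ᶻ_ : Series → ZSeries → ZSeries
(s ·ᶻ X) α = s ⊗ X α

mulFactors-·ᶻ : ∀ L s X → mulFactors L (s ·ᶻ X) ≋ s ·ᶻ mulFactors L X
mulFactors-·ᶻ [] s X = ≋-refl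
mulFactors-·ᶻ ((a , b) ∷ L) s X = ≋-trans (mulFactor-cong (a , b) (mulFactors-·ᶻ L s X)) λ α →
  solve 4 (λ s A x C → s :* A :+ x :* (s :* C) := s :* (A :+ x :* C)) ≈-refl
    s (mulFactors L X α) (q^ b) (mulFactors L X (α - a))

infix 4 _≃_
record _≃_ (L M : List Factor) : Set where
  constructor mk≃
  field mulFactors-≃ : ∀ X → mulFactors L X ≋ mulFactors M X
open _≃_

≃-setoid : Setoid 0ℓ 0ℓ
≃-setoid = record
  { Carrier = List Factor ; _≈_ = _≃_
  ; isEquivalence = record
    { refl = mk≃ λ X → ≋-refl
    ; sym = λ e → mk≃ λ X → ≋-sym (mulFactors-≃ e X)
    ; trans = λ e e′ → mk≃ λ X → ≋-trans (mulFactors-≃ e X) (mulFactors-≃ e′ X) } }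

open Setoid ≃-setoid public using () renaming (refl to ≃-refl; sym to ≃-sym)

≃-++ : ∀ {L L′ M M′} → L ≃ L′ → M ≃ M′ → (L ++ M) ≃ (L′ ++ M′)
≃-++ {L} {L′} {M} {M′} e e′ = mk≃ λ X → ≋-trans (mulFactors-++ L M X)
  (≋-trans (mulFactors-cong L (mulFactors-≃ e′ X)) (≋-trans (mulFactors-≃ e _) (≋-sym (mulFactors-++ L′ M′ X))))

++-comm-≃ : ∀ L M → (L ++ M) ≃ (M ++ L)
++-comm-≃ L M = mk≃ λ X → ≋-trans (mulFactors-++ L M X) (≋-trans (mulFactors-comm L M X) (≋-sym (mulFactors-++ M L X)))

repeat : ℕ → List Factor → List Factor
repeat zero L = []
repeat (suc k) L = L ++ repeat k L

repeat-++ : ∀ k A B → repeat k (A ++ B) ≃ (repeat k A ++ repeat k B)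
repeat-++ zero A B = ≃-refl
repeat-++ (suc k) A B = begin
  (A ++ B) ++ repeat k (A ++ B)   ≈⟨ ≃-++ ≃-refl (repeat-++ k A B) ⟩
  (A ++ B) ++ (RA ++ RB)          ≡⟨ LP.++-assoc A B (RA ++ RB) ⟩
  A ++ (B ++ (RA ++ RB))          ≡⟨ cong (A ++_) (LP.++-assoc B RA RB) ⟨
  A ++ ((B ++ RA) ++ RB)          ≈⟨ ≃-++ {A} ≃-refl (≃-++ {M = RB} (++-comm-≃ B RA) ≃-refl) ⟩
  A ++ ((RA ++ B) ++ RB)          ≡⟨ cong (A ++_) (LP.++-assoc RA B RB) ⟩
  A ++ (RA ++ (B ++ RB))          ≡⟨ LP.++-assoc A RA (B ++ RB) ⟨
  (A ++ RA) ++ (B ++ RB)          ∎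
  where
  open SetoidReasoning ≃-setoid
  RA = repeat k A
  RB = repeat k B

iterate : ℕ → (ZSeries → ZSeries) → ZSeries → ZSeries
iterate zero F X = X
iterate (suc k) F X = F (iterate k F X)

mulFactors-repeat : ∀ k L X → mulFactors (repeat k L) X ≋ iterate k (mulFactors L) X
mulFactors-repeat zero L X = ≋-refl
mulFactors-repeat (suc k) L X = ≋-trans (mulFactors-++ L (repeat k L) X) (mulFactors-cong L (mulFactors-repeat k L X))

zFactor z⁻¹Factor : ℕ → Factor
zFactor l = (+ 1 , suc l)
z⁻¹Factor l = (- (+ 1) , l)

block : ℕ → ℕ → List Factor
block k l = replicate k (zFactor l) ++ replicate k (z⁻¹Factor l)

replicate≡repeat : ∀ k (f : Factor) → replicate k f ≡ repeat k (f ∷ [])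
replicate≡repeat zero f = refl
replicate≡repeat (suc k) f = cong (f ∷_) (replicate≡repeat k f)

concatMap-block : ∀ k ls → concatMap (block k) ls ≃ repeat k (concatMap (block 1) ls)
concatMap-block k [] = ≃-sym (repeat-empty k)
  where
  repeat-empty : ∀ k → repeat k [] ≃ []
  repeat-empty zero = ≃-refl
  repeat-empty (suc k) = repeat-empty k
concatMap-block k (l ∷ ls) = begin
  block k l ++ concatMap (block k) ls
    ≈⟨ ≃-++ block≃ (concatMap-block k ls) ⟩
  repeat k (block 1 l) ++ repeat k (concatMap (block 1) ls)
    ≈⟨ repeat-++ k (block 1 l) (concatMap (block 1) ls) ⟨
  repeat k (block 1 l ++ concatMap (block 1) ls) ∎
  where
  open SetoidReasoning ≃-setoid
  block≃ : block k l ≃ repeat k (block 1 l)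
  block≃ = begin
    replicate k (zFactor l) ++ replicate k (z⁻¹Factor l)
      ≡⟨ cong₂ _++_ (replicate≡repeat k (zFactor l)) (replicate≡repeat k (z⁻¹Factor l)) ⟩
    repeat k (zFactor l ∷ []) ++ repeat k (z⁻¹Factor l ∷ [])
      ≈⟨ repeat-++ k (zFactor l ∷ []) (z⁻¹Factor l ∷ []) ⟨
    repeat k (block 1 l) ∎

mulFactors-factors : ∀ k N X → mulFactors (factors k N) X ≋ iterate k (mulFactors (factors 1 N)) X
mulFactors-factors k N X = ≋-trans (mulFactors-≃ (concatMap-block k (upTo (suc N))) X) (mulFactors-repeat k (factors 1 N) X)

mulFactors-high : ∀ L K Y → All (λ f → K ℕ.≤ proj₂ f) L → mulFactors L Y ≋[ K ] Y
mulFactors-high [] K Y _ = λ α n _ → refl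
mulFactors-high ((a , b) ∷ L) K Y (K≤b ∷ K≤L) =
  ≋[]-trans (λ α → ⊕-q^⊗-below (mulFactors L Y α) _ b K K≤b) (mulFactors-high L K Y K≤L)

concatMap-upTo-suc : ∀ (f : ℕ → List Factor) n → concatMap f (upTo (suc n)) ≡ concatMap f (upTo n) ++ f n
concatMap-upTo-suc f n = begin
  concatMap f (upTo (suc n))              ≡⟨ cong (concatMap f) (LP.upTo-∷ʳ n) ⟨
  concatMap f (upTo n ++ n ∷ [])          ≡⟨ LP.concatMap-++ f (upTo n) (n ∷ []) ⟩
  concatMap f (upTo n) ++ (f n ++ [])     ≡⟨ cong (concatMap f (upTo n) ++_) (LP.++-identityʳ (f n)) ⟩
  concatMap f (upTo n) ++ f n             ∎
  where open ≡-Reasoning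

prod-factors-suc : ∀ k N → prod (factors k (suc N)) ≋[ suc N ] prod (factors k N)
prod-factors-suc k N = ≋[]-trans (≋⇒≋[] (suc N) reorder)
  (mulFactors-high (block k (suc N)) (suc N) _ (++⁺ (replicate⁺ k (ℕP.n≤1+n (suc N))) (replicate⁺ k ℕP.≤-refl)))
  where
  reorder : prod (factors k (suc N)) ≋ mulFactors (block k (suc N)) (prod (factors k N))
  reorder rewrite concatMap-upTo-suc (block k) (suc N) =
    ≋-trans (mulFactors-++ (factors k N) (block k (suc N)) 𝟙ᶻ) (mulFactors-comm (factors k N) (block k (suc N)) 𝟙ᶻ)

prod-factors-stable : ∀ k α i d → prod (factors k (d ℕ.+ i)) α i ≡ prod (factors k i) α i
prod-factors-stable k α i zero = refl
prod-factors-stable k α i (suc d) =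
  trans (prod-factors-suc k (d ℕ.+ i) α i (s≤s (ℕP.m≤n+m i d))) (prod-factors-stable k α i d)

CΦ≈[]prod : ∀ k α n → CΦ k α ≈[ suc n ] prod (factors k n) α
CΦ≈[]prod k α n i (s≤s i≤n) = trans (coeffProd≡prod (factors k i) α i)
  (sym (trans (cong (λ t → prod (factors k t) α i) (sym (ℕP.m∸n+n≡m i≤n))) (prod-factors-stable k α i (n ∸ i))))

q^⊗q^⊗ : ∀ a b X → (q^ a ⊗ (q^ b ⊗ X)) ≈ (q^ (a ℕ.+ b) ⊗ X)
q^⊗q^⊗ a b X = ≈-trans (≈-sym (⊗-assoc (q^ a) (q^ b) X)) (⊗-congʳ X (q^-+ a b))

q^⊗-cong : ∀ {a b} X → a ≡ b → (q^ a ⊗ X) ≈ (q^ b ⊗ X)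
q^⊗-cong X refl = ≈-refl

qBinomPrev : ℕ → ℕ → Series
qBinomPrev M zero = 𝟘
qBinomPrev M (suc j) = qBinom M j

q^⊗qBinomPrev-cong : ∀ M j {x y} → (j ℕ.≤ suc M → x ≡ y) → (q^ x ⊗ qBinomPrev M j) ≈ (q^ y ⊗ qBinomPrev M j)
q^⊗qBinomPrev-cong M zero _ = ≈-trans (⊗-zeroʳ _) (≈-sym (⊗-zeroʳ _))
q^⊗qBinomPrev-cong M (suc j) x≡y = q^⊗qBinom-cong M j (λ j≤M → x≡y (s≤s j≤M))

qBinom-four-term : ∀ M j → qBinom (suc (suc M)) (suc j)
  ≈ (qBinom M j ⊕ q^ (suc M) ⊗ qBinom M j ⊕ q^ (suc M ∸ j) ⊗ qBinomPrev M j ⊕ q^ (suc j) ⊗ qBinom M (suc j))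
qBinom-four-term M zero = begin
  𝟙 ⊕ q^ 1 ⊗ qBinom (suc M) 1
    ≈⟨ ⊕-cong ≈-refl (⊗-congˡ (q^ 1) (qBinom-pascal′ M 0)) ⟩
  𝟙 ⊕ q^ 1 ⊗ (q^ M ⊗ 𝟙 ⊕ qBinom M 1)
    ≈⟨ solve 4 (λ o x y C → o :+ x :* (y :* o :+ C) := o :+ (x :* y) :* o :+ x :* C) ≈-refl 𝟙 (q^ 1) (q^ M) (qBinom M 1) ⟩
  𝟙 ⊕ (q^ 1 ⊗ q^ M) ⊗ 𝟙 ⊕ q^ 1 ⊗ qBinom M 1
    ≈⟨ ⊕-cong (⊕-cong ≈-refl (⊗-congʳ 𝟙 (q^-+ 1 M))) ≈-refl ⟩
  𝟙 ⊕ q^ (suc M) ⊗ 𝟙 ⊕ q^ 1 ⊗ qBinom M 1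
    ≈⟨ ⊕-cong (⊕-identityʳ _) ≈-refl ⟨
  𝟙 ⊕ q^ (suc M) ⊗ 𝟙 ⊕ 𝟘 ⊕ q^ 1 ⊗ qBinom M 1
    ≈⟨ ⊕-cong (⊕-cong ≈-refl (⊗-zeroʳ (q^ (suc M)))) ≈-refl ⟨
  𝟙 ⊕ q^ (suc M) ⊗ 𝟙 ⊕ q^ (suc M) ⊗ 𝟘 ⊕ q^ 1 ⊗ qBinom M 1 ∎
  where open ≈-Reasoning
qBinom-four-term M (suc j) = begin
  qBinom (suc M) (suc j) ⊕ z ⊗ qBinom (suc M) (suc (suc j))
    ≈⟨ ⊕-cong (qBinom-pascal′ M j) (⊗-congˡ z (qBinom-pascal′ M (suc j))) ⟩
  (w ⊗ A ⊕ C) ⊕ z ⊗ (v ⊗ C ⊕ E)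
    ≈⟨ solve 6 (λ w A C z v E → (w :* A :+ C) :+ z :* (v :* C :+ E) := C :+ (z :* v) :* C :+ w :* A :+ z :* E) ≈-refl w A C z v E ⟩
  C ⊕ (z ⊗ v) ⊗ C ⊕ w ⊗ A ⊕ z ⊗ E
    ≈⟨ ⊕-cong (⊕-cong (⊕-cong ≈-refl zvC≈) ≈-refl) ≈-refl ⟩
  C ⊕ q^ (suc M) ⊗ C ⊕ w ⊗ A ⊕ z ⊗ E ∎
  where
  open ≈-Reasoning
  w = q^ (M ∸ j)
  A = qBinom M j
  C = qBinom M (suc j)
  z = q^ (suc (suc j))
  v = q^ (M ∸ suc j)
  E = qBinom M (suc (suc j))
  zvC≈ : ((z ⊗ v) ⊗ C) ≈ (q^ (suc M) ⊗ C)
  zvC≈ = ≈-trans (⊗-congʳ C (q^-+ (suc (suc j)) (M ∸ suc j)))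
                 (q^⊗qBinom-cong M (suc j) (λ sj≤M → cong suc (ℕP.m+[n∸m]≡n sj≤M)))

-- The finite Jacobi triple product

triangle : ℕ → ℕ
triangle zero = zero
triangle (suc m) = triangle m ℕ.+ suc m

-- triangleℤ α = α(α+1)/2.
triangleℤ : ℤ → ℕ
triangleℤ (+ a) = triangle a
triangleℤ -[1+ a ] = triangle a

triangle-pred : ∀ a → triangle a ≡ triangle (ℕ.pred a) ℕ.+ a
triangle-pred zero = refl
triangle-pred (suc a) = refl

≤-triangle : ∀ a → a ℕ.≤ triangle a
≤-triangle zero = z≤n
≤-triangle (suc a) = ℕP.m≤n+m (suc a) (triangle a)

-- qBinomDown M u a = [M u-1-a], and 0 for a ≥ u.
qBinomDown : ℕ → ℕ → ℕ → Series
qBinomDown M zero a = 𝟘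
qBinomDown M (suc u) zero = qBinom M u
qBinomDown M (suc u) (suc a) = qBinomDown M u a

qBinomDown-vanish : ∀ M u a → u ℕ.≤ a → qBinomDown M u a ≈ 𝟘
qBinomDown-vanish M zero a _ = ≈-refl
qBinomDown-vanish M (suc u) (suc a) (s≤s u≤a) = qBinomDown-vanish M u a u≤a

qBinomDown-< : ∀ M u a → a ℕ.< u → qBinomDown M u a ≈ qBinom M (u ∸ suc a)
qBinomDown-< M (suc u) zero _ = ≈-refl
qBinomDown-< M (suc u) (suc a) (s≤s a<u) = qBinomDown-< M u a a<u

qBinomDown-suc : ∀ M u a → a ℕ.< u → qBinomDown M u (suc a) ≈ qBinomPrev M (u ∸ suc a)
qBinomDown-suc M (suc zero) zero _ = ≈-refl
qBinomDown-suc M (suc (suc u)) zero _ = ≈-refl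
qBinomDown-suc M (suc u) (suc a) (s≤s a<u) = qBinomDown-suc M u a a<u

-- centralQBinom u α = [2u u+α].
centralQBinom : ℕ → ℤ → Series
centralQBinom u (+ a) = qBinom (u ℕ.+ u) (u ℕ.+ a)
centralQBinom u -[1+ a ] = qBinomDown (u ℕ.+ u) u a

jacobiPartial : ℕ → ZSeries
jacobiPartial u α = q^ (triangleℤ α) ⊗ centralQBinom u α

jacobiFactors : ℕ → List Factor
jacobiFactors u = concatMap (block 1) (upTo u)

mulFactors-block : ∀ u X α → mulFactors (block 1 u) X α
  ≈ ((X α ⊕ q^ u ⊗ X (α - - + 1)) ⊕ q^ (suc u) ⊗ (X (α - + 1) ⊕ q^ u ⊗ X α))
mulFactors-block u X α = ⊕-cong ≈-refl (⊗-congˡ (q^ (suc u)) (⊕-cong ≈-refl (⊗-congˡ (q^ u) (ZSeries-at X (cancel α)))))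
  where
  cancel : ∀ α → α - + 1 - - + 1 ≡ α
  cancel = solveℤ

-- The induction step of the finite triple product, via the four-term recurrence for [M+2 j+1].
jacobi-step : ∀ u j e₀ e₁ e₂ (X₀ X₁ X₂ : Series) →
  X₀ ≈ (q^ e₀ ⊗ qBinom (u ℕ.+ u) j) → X₁ ≈ (q^ e₁ ⊗ qBinom (u ℕ.+ u) (suc j)) → X₂ ≈ (q^ e₂ ⊗ qBinomPrev (u ℕ.+ u) j) →
  u ℕ.+ e₁ ≡ e₀ ℕ.+ suc j → (j ℕ.≤ suc (u ℕ.+ u) → suc u ℕ.+ e₂ ≡ e₀ ℕ.+ (suc (u ℕ.+ u) ∸ j)) →
  ((X₀ ⊕ q^ u ⊗ X₁) ⊕ q^ (suc u) ⊗ (X₂ ⊕ q^ u ⊗ X₀)) ≈ (q^ e₀ ⊗ qBinom (suc (suc (u ℕ.+ u))) (suc j))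
jacobi-step u j e₀ e₁ e₂ X₀ X₁ X₂ X₀≈ X₁≈ X₂≈ e₁≡ e₂≡ = begin
  (X₀ ⊕ q^ u ⊗ X₁) ⊕ q^ (suc u) ⊗ (X₂ ⊕ q^ u ⊗ X₀)
    ≈⟨ ⊕-cong (⊕-cong X₀≈ (⊗-congˡ (q^ u) X₁≈)) (⊗-congˡ (q^ (suc u)) (⊕-cong X₂≈ (⊗-congˡ (q^ u) X₀≈))) ⟩
  (q^ e₀ ⊗ P ⊕ q^ u ⊗ (q^ e₁ ⊗ R)) ⊕ q^ (suc u) ⊗ (q^ e₂ ⊗ Q ⊕ q^ u ⊗ (q^ e₀ ⊗ P))
    ≈⟨ solve 8 (λ a P b R c d Q f → (a :* P :+ b :* (c :* R)) :+ d :* (f :* Q :+ b :* (a :* P))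
                                  := a :* P :+ d :* (b :* (a :* P)) :+ d :* (f :* Q) :+ b :* (c :* R)) ≈-refl
         (q^ e₀) P (q^ u) R (q^ e₁) (q^ (suc u)) Q (q^ e₂) ⟩
  q^ e₀ ⊗ P ⊕ q^ (suc u) ⊗ (q^ u ⊗ (q^ e₀ ⊗ P)) ⊕ q^ (suc u) ⊗ (q^ e₂ ⊗ Q) ⊕ q^ u ⊗ (q^ e₁ ⊗ R)
    ≈⟨ ⊕-cong (⊕-cong (⊕-cong ≈-refl term₁) term₂) term₃ ⟩
  q^ e₀ ⊗ P ⊕ q^ e₀ ⊗ (q^ (suc M) ⊗ P) ⊕ q^ e₀ ⊗ (q^ (suc M ∸ j) ⊗ Q) ⊕ q^ e₀ ⊗ (q^ (suc j) ⊗ R)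
    ≈⟨ solve 7 (λ a P x y Q z R → a :* P :+ a :* (x :* P) :+ a :* (y :* Q) :+ a :* (z :* R)
                                := a :* (P :+ x :* P :+ y :* Q :+ z :* R)) ≈-refl
         (q^ e₀) P (q^ (suc M)) (q^ (suc M ∸ j)) Q (q^ (suc j)) R ⟩
  q^ e₀ ⊗ (P ⊕ q^ (suc M) ⊗ P ⊕ q^ (suc M ∸ j) ⊗ Q ⊕ q^ (suc j) ⊗ R)
    ≈⟨ ⊗-congˡ (q^ e₀) (qBinom-four-term M j) ⟨
  q^ e₀ ⊗ qBinom (suc (suc M)) (suc j) ∎
  where
  open ≈-Reasoning
  M = u ℕ.+ u
  P = qBinom M j
  Q = qBinomPrev M j
  R = qBinom M (suc j)
  split : ∀ a b X → (q^ (a ℕ.+ b) ⊗ X) ≈ (q^ a ⊗ (q^ b ⊗ X))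
  split a b X = ≈-sym (q^⊗q^⊗ a b X)
  e₀-last : ∀ u e₀ → suc u ℕ.+ (u ℕ.+ e₀) ≡ e₀ ℕ.+ suc (u ℕ.+ u)
  e₀-last = solveℕ
  term₁ : (q^ (suc u) ⊗ (q^ u ⊗ (q^ e₀ ⊗ P))) ≈ (q^ e₀ ⊗ (q^ (suc M) ⊗ P))
  term₁ = ≈-trans (⊗-congˡ (q^ (suc u)) (q^⊗q^⊗ u e₀ P))
         (≈-trans (q^⊗q^⊗ (suc u) (u ℕ.+ e₀) P) (≈-trans (q^⊗-cong P (e₀-last u e₀)) (split e₀ (suc M) P)))
  term₂ : (q^ (suc u) ⊗ (q^ e₂ ⊗ Q)) ≈ (q^ e₀ ⊗ (q^ (suc M ∸ j) ⊗ Q))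
  term₂ = ≈-trans (q^⊗q^⊗ (suc u) e₂ Q) (≈-trans (q^⊗qBinomPrev-cong M j e₂≡) (split e₀ (suc M ∸ j) Q))
  term₃ : (q^ u ⊗ (q^ e₁ ⊗ R)) ≈ (q^ e₀ ⊗ (q^ (suc j) ⊗ R))
  term₃ = ≈-trans (q^⊗q^⊗ u e₁ R) (≈-trans (q^⊗-cong R e₁≡) (split e₀ (suc j) R))

private
  +-suc-suc : ∀ u → suc u ℕ.+ suc u ≡ suc (suc (u ℕ.+ u))
  +-suc-suc u = cong suc (ℕP.+-suc u u)

  ∸-suc : ∀ {a u} → a ℕ.< u → u ∸ a ≡ suc (u ∸ suc a)
  ∸-suc a<u = ℕP.+-∸-assoc 1 a<u

  qBinom-at : ∀ {M M′ j j′} → M ≡ M′ → j ≡ j′ → qBinom M j ≈ qBinom M′ j′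
  qBinom-at refl refl = ≈-refl

  qBinomPrev-at : ∀ M {j j′} → j ≡ j′ → qBinomPrev M j ≈ qBinomPrev M j′
  qBinomPrev-at M refl = ≈-refl

jacobiPartial-step-nonneg : ∀ u a → mulFactors (block 1 u) (jacobiPartial u) (+ a) ≈ jacobiPartial (suc u) (+ a)
jacobiPartial-step-nonneg u a = ≈-trans (mulFactors-block u (jacobiPartial u) (+ a))
  (≈-trans (jacobi-step u (u ℕ.+ a) (triangle a) (triangle (suc a)) (triangle (ℕ.pred a)) _ _ _ ≈-refl X₁≈ (X₂≈ u a) e₁≡ e₂≡)
           (⊗-congˡ (q^ (triangle a)) (qBinom-at {j = suc (u ℕ.+ a)} (sym (+-suc-suc u)) refl)))
  where
  M = u ℕ.+ u
  X₁≈ : jacobiPartial u (+ a - - + 1) ≈ (q^ (triangle (suc a)) ⊗ qBinom M (suc (u ℕ.+ a)))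
  X₁≈ = ≈-trans (ZSeries-at (jacobiPartial u) (cong +_ (ℕP.+-comm a 1))) (⊗-congˡ _ (qBinom-at refl (ℕP.+-suc u a)))
  X₂≈ : ∀ u a → jacobiPartial u (+ a - + 1) ≈ (q^ (triangle (ℕ.pred a)) ⊗ qBinomPrev (u ℕ.+ u) (u ℕ.+ a))
  X₂≈ zero zero = ≈-refl
  X₂≈ (suc u) zero = ⊗-congˡ (q^ 0) (qBinomPrev-at _ (sym (ℕP.+-identityʳ (suc u))))
  X₂≈ u (suc a) = ⊗-congˡ (q^ (triangle a)) (qBinomPrev-at _ (sym (ℕP.+-suc u a)))
  e₁≡ : u ℕ.+ triangle (suc a) ≡ triangle a ℕ.+ suc (u ℕ.+ a)
  e₁≡ = rearrange u (triangle a) a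
    where
    rearrange : ∀ u t a → u ℕ.+ (t ℕ.+ suc a) ≡ t ℕ.+ suc (u ℕ.+ a)
    rearrange = solveℕ
  e₂≡ : u ℕ.+ a ℕ.≤ suc M → suc u ℕ.+ triangle (ℕ.pred a) ≡ triangle a ℕ.+ (suc M ∸ (u ℕ.+ a))
  e₂≡ u+a≤ = sym (begin
    triangle a ℕ.+ (suc M ∸ (u ℕ.+ a))             ≡⟨ cong (λ t → triangle a ℕ.+ (t ∸ (u ℕ.+ a))) (ℕP.+-suc u u) ⟨
    triangle a ℕ.+ (u ℕ.+ suc u ∸ (u ℕ.+ a))       ≡⟨ cong (triangle a ℕ.+_) (ℕP.[m+n]∸[m+o]≡n∸o u (suc u) a) ⟩
    triangle a ℕ.+ (suc u ∸ a)                     ≡⟨ cong (ℕ._+ (suc u ∸ a)) (triangle-pred a) ⟩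
    triangle (ℕ.pred a) ℕ.+ a ℕ.+ (suc u ∸ a)      ≡⟨ ℕP.+-assoc (triangle (ℕ.pred a)) a (suc u ∸ a) ⟩
    triangle (ℕ.pred a) ℕ.+ (a ℕ.+ (suc u ∸ a))    ≡⟨ cong (triangle (ℕ.pred a) ℕ.+_) (ℕP.m+[n∸m]≡n a≤su) ⟩
    triangle (ℕ.pred a) ℕ.+ suc u                  ≡⟨ ℕP.+-comm (triangle (ℕ.pred a)) (suc u) ⟩
    suc u ℕ.+ triangle (ℕ.pred a)                  ∎)
    where
    open ≡-Reasoning
    a≤su : a ℕ.≤ suc u
    a≤su = ℕP.+-cancelˡ-≤ u a (suc u) (subst (u ℕ.+ a ℕ.≤_) (sym (ℕP.+-suc u u)) u+a≤)

jacobiPartial-outside : ∀ u a → u ℕ.≤ a → jacobiPartial u -[1+ a ] ≈ 𝟘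
jacobiPartial-outside u a u≤a = ⊗-zeroʳ′ (q^ (triangle a)) (qBinomDown-vanish (u ℕ.+ u) u a u≤a)

jacobiPartial-step-inner : ∀ u a → a ℕ.< u → mulFactors (block 1 u) (jacobiPartial u) -[1+ a ] ≈ jacobiPartial (suc u) -[1+ a ]
jacobiPartial-step-inner u a a<u = ≈-trans (mulFactors-block u (jacobiPartial u) -[1+ a ])
  (≈-trans (jacobi-step u j (triangle a) (triangle (ℕ.pred a)) (triangle (suc a)) _ _ _ X₀≈ (X₁≈ a a<u) X₂≈ e₁≡ (λ _ → e₂≡))
           (⊗-congˡ (q^ (triangle a)) (≈-sym (≈-trans (qBinomDown-< (suc u ℕ.+ suc u) (suc u) a (ℕP.m≤n⇒m≤1+n a<u))
                                                      (qBinom-at (+-suc-suc u) (∸-suc a<u))))))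
  where
  M = u ℕ.+ u
  j = u ∸ suc a
  a+j≡ : suc a ℕ.+ j ≡ u
  a+j≡ = ℕP.m+[n∸m]≡n a<u
  X₀≈ : jacobiPartial u -[1+ a ] ≈ (q^ (triangle a) ⊗ qBinom M j)
  X₀≈ = ⊗-congˡ (q^ (triangle a)) (qBinomDown-< M u a a<u)
  X₁≈ : ∀ a → a ℕ.< u → jacobiPartial u (-[1+ a ] - - + 1) ≈ (q^ (triangle (ℕ.pred a)) ⊗ qBinom M (suc (u ∸ suc a)))
  X₁≈ zero a<u = ⊗-congˡ (q^ 0) (qBinom-at refl (trans (ℕP.+-identityʳ u) (∸-suc a<u)))
  X₁≈ (suc a) a<u = ⊗-congˡ (q^ (triangle a))
    (≈-trans (qBinomDown-< M u a (ℕP.<-trans (ℕP.n<1+n a) a<u)) (qBinom-at refl (∸-suc a<u)))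
  X₂≈ : jacobiPartial u (-[1+ a ] - + 1) ≈ (q^ (triangle (suc a)) ⊗ qBinomPrev M j)
  X₂≈ = ≈-trans (ZSeries-at (jacobiPartial u) (cong (λ t → -[1+ suc t ]) (ℕP.+-identityʳ a)))
                (⊗-congˡ (q^ (triangle (suc a))) (qBinomDown-suc M u a a<u))
  e₁≡ : u ℕ.+ triangle (ℕ.pred a) ≡ triangle a ℕ.+ suc j
  e₁≡ = begin
    u ℕ.+ triangle (ℕ.pred a)                 ≡⟨ cong (ℕ._+ triangle (ℕ.pred a)) a+j≡ ⟨
    suc a ℕ.+ j ℕ.+ triangle (ℕ.pred a)       ≡⟨ rearrange a j (triangle (ℕ.pred a)) ⟩
    triangle (ℕ.pred a) ℕ.+ a ℕ.+ suc j       ≡⟨ cong (ℕ._+ suc j) (triangle-pred a) ⟨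
    triangle a ℕ.+ suc j                      ∎
    where
    open ≡-Reasoning
    rearrange : ∀ a j t → suc a ℕ.+ j ℕ.+ t ≡ t ℕ.+ a ℕ.+ suc j
    rearrange = solveℕ
  e₂≡ : suc u ℕ.+ triangle (suc a) ≡ triangle a ℕ.+ (suc M ∸ j)
  e₂≡ = begin
    suc u ℕ.+ triangle (suc a)                ≡⟨ rearrange₁ u (triangle a) a ⟩
    triangle a ℕ.+ suc (u ℕ.+ suc a)          ≡⟨ cong (triangle a ℕ.+_) (ℕP.m+n∸m≡n j _) ⟨
    triangle a ℕ.+ (j ℕ.+ suc (u ℕ.+ suc a) ∸ j) ≡⟨ cong (λ t → triangle a ℕ.+ (t ∸ j)) (rearrange₂ u a j) ⟨
    triangle a ℕ.+ (suc (u ℕ.+ (suc a ℕ.+ j)) ∸ j) ≡⟨ cong (λ t → triangle a ℕ.+ (suc (u ℕ.+ t) ∸ j)) a+j≡ ⟩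
    triangle a ℕ.+ (suc M ∸ j)                ∎
    where
    open ≡-Reasoning
    rearrange₁ : ∀ u t a → suc u ℕ.+ (t ℕ.+ suc a) ≡ t ℕ.+ suc (u ℕ.+ suc a)
    rearrange₁ = solveℕ
    rearrange₂ : ∀ u a j → suc (u ℕ.+ (suc a ℕ.+ j)) ≡ j ℕ.+ suc (u ℕ.+ suc a)
    rearrange₂ = solveℕ

private
  drop-zero-terms : ∀ x y w → ((𝟘 ⊕ x ⊗ y) ⊕ w ⊗ (𝟘 ⊕ x ⊗ 𝟘)) ≈ (x ⊗ y)
  drop-zero-terms x y w = ≈-trans (⊕-cong (⊕-identityˡ _) (⊗-zeroʳ′ w (≈-trans (⊕-identityˡ _) (⊗-zeroʳ x))))
                                  (⊕-identityʳ _)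

jacobiPartial-step-edge : ∀ u → mulFactors (block 1 u) (jacobiPartial u) -[1+ u ] ≈ jacobiPartial (suc u) -[1+ u ]
jacobiPartial-step-edge u = begin
  mulFactors (block 1 u) (jacobiPartial u) -[1+ u ]
    ≈⟨ mulFactors-block u (jacobiPartial u) -[1+ u ] ⟩
  (Jᵤ -[1+ u ] ⊕ q^ u ⊗ Jᵤ (-[1+ u ] - - + 1)) ⊕ q^ (suc u) ⊗ (Jᵤ (-[1+ u ] - + 1) ⊕ q^ u ⊗ Jᵤ -[1+ u ])
    ≈⟨ ⊕-cong (⊕-cong Jᵤ≈0 (⊗-congˡ (q^ u) (inner u))) (⊗-congˡ (q^ (suc u)) (⊕-cong Jᵤ′≈0 (⊗-congˡ (q^ u) Jᵤ≈0))) ⟩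
  (𝟘 ⊕ q^ u ⊗ (q^ (triangle (ℕ.pred u)) ⊗ 𝟙)) ⊕ q^ (suc u) ⊗ (𝟘 ⊕ q^ u ⊗ 𝟘)
    ≈⟨ drop-zero-terms (q^ u) _ (q^ (suc u)) ⟩
  q^ u ⊗ (q^ (triangle (ℕ.pred u)) ⊗ 𝟙)
    ≈⟨ q^⊗q^⊗ u (triangle (ℕ.pred u)) 𝟙 ⟩
  q^ (u ℕ.+ triangle (ℕ.pred u)) ⊗ 𝟙
    ≈⟨ q^⊗-cong 𝟙 (trans (ℕP.+-comm u _) (sym (triangle-pred u))) ⟩
  q^ (triangle u) ⊗ 𝟙
    ≈⟨ ⊗-congˡ (q^ (triangle u)) (corner u) ⟨
  jacobiPartial (suc u) -[1+ u ] ∎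
  where
  open ≈-Reasoning
  Jᵤ = jacobiPartial u
  Jᵤ≈0 : Jᵤ -[1+ u ] ≈ 𝟘
  Jᵤ≈0 = jacobiPartial-outside u u ℕP.≤-refl
  Jᵤ′≈0 : Jᵤ (-[1+ u ] - + 1) ≈ 𝟘
  Jᵤ′≈0 = ≈-trans (ZSeries-at Jᵤ (cong (λ t → -[1+ suc t ]) (ℕP.+-identityʳ u))) (jacobiPartial-outside u (suc u) (ℕP.n≤1+n u))
  corner : ∀ u → qBinomDown (suc u ℕ.+ suc u) (suc u) u ≈ 𝟙
  corner u = ≈-trans (qBinomDown-< _ (suc u) u ℕP.≤-refl) (qBinom-at refl (ℕP.n∸n≡0 u))
  inner : ∀ u → jacobiPartial u (-[1+ u ] - - + 1) ≈ (q^ (triangle (ℕ.pred u)) ⊗ 𝟙)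
  inner zero = ≈-refl
  inner (suc u) = ⊗-congˡ (q^ (triangle u)) (corner u)

jacobiPartial-step-outer : ∀ u a → u ℕ.< a → mulFactors (block 1 u) (jacobiPartial u) -[1+ a ] ≈ jacobiPartial (suc u) -[1+ a ]
jacobiPartial-step-outer u (suc a) (s≤s u≤a) = begin
  mulFactors (block 1 u) (jacobiPartial u) -[1+ suc a ]
    ≈⟨ mulFactors-block u (jacobiPartial u) -[1+ suc a ] ⟩
  (Jᵤ -[1+ suc a ] ⊕ q^ u ⊗ Jᵤ -[1+ a ]) ⊕ q^ (suc u) ⊗ (Jᵤ (-[1+ suc a ] - + 1) ⊕ q^ u ⊗ Jᵤ -[1+ suc a ])
    ≈⟨ ⊕-cong (⊕-cong Jᵤ≈0 (⊗-congˡ (q^ u) (jacobiPartial-outside u a u≤a)))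
              (⊗-congˡ (q^ (suc u)) (⊕-cong Jᵤ′≈0 (⊗-congˡ (q^ u) Jᵤ≈0))) ⟩
  (𝟘 ⊕ q^ u ⊗ 𝟘) ⊕ q^ (suc u) ⊗ (𝟘 ⊕ q^ u ⊗ 𝟘)
    ≈⟨ drop-zero-terms (q^ u) 𝟘 (q^ (suc u)) ⟩
  q^ u ⊗ 𝟘
    ≈⟨ ⊗-zeroʳ (q^ u) ⟩
  𝟘
    ≈⟨ jacobiPartial-outside (suc u) (suc a) (s≤s u≤a) ⟨
  jacobiPartial (suc u) -[1+ suc a ] ∎
  where
  open ≈-Reasoning
  Jᵤ = jacobiPartial u
  Jᵤ≈0 : Jᵤ -[1+ suc a ] ≈ 𝟘
  Jᵤ≈0 = jacobiPartial-outside u (suc a) (ℕP.m≤n⇒m≤1+n u≤a)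
  Jᵤ′≈0 : Jᵤ (-[1+ suc a ] - + 1) ≈ 𝟘
  Jᵤ′≈0 = ≈-trans (ZSeries-at Jᵤ (cong (λ t → -[1+ suc t ]) (ℕP.+-identityʳ (suc a))))
                 (jacobiPartial-outside u (suc (suc a)) (ℕP.m≤n⇒m≤1+n (ℕP.m≤n⇒m≤1+n u≤a)))

jacobiPartial-step : ∀ u α → mulFactors (block 1 u) (jacobiPartial u) α ≈ jacobiPartial (suc u) α
jacobiPartial-step u (+ a) = jacobiPartial-step-nonneg u a
jacobiPartial-step u -[1+ a ] with ℕP.<-cmp a u
... | tri< a<u _ _ = jacobiPartial-step-inner u a a<u
... | tri≈ _ refl _ = jacobiPartial-step-edge a
... | tri> _ _ u<a = jacobiPartial-step-outer u a u<a

prod-jacobiFactors : ∀ u → prod (jacobiFactors u) ≋ jacobiPartial u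
prod-jacobiFactors zero (+ zero) = ≈-sym (⊗-identityˡ 𝟙)
prod-jacobiFactors zero (+ suc a) = ≈-sym (⊗-zeroʳ _)
prod-jacobiFactors zero -[1+ a ] = ≈-sym (⊗-zeroʳ _)
prod-jacobiFactors (suc u) = subst (λ L → prod L ≋ jacobiPartial (suc u)) (sym (concatMap-upTo-suc (block 1) u))
  (≋-trans (mulFactors-++ (jacobiFactors u) (block 1 u) 𝟙ᶻ)
  (≋-trans (mulFactors-comm (jacobiFactors u) (block 1 u) 𝟙ᶻ)
  (≋-trans (mulFactors-cong (block 1 u) (prod-jacobiFactors u)) (jacobiPartial-step u))))

private
  qPochInf⊗q^⊗ : ∀ K t X → (qPochInf ⊗ X) ≈[ K ∸ t ] 𝟙 → (qPochInf ⊗ (q^ t ⊗ X)) ≈[ K ] q^ t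
  qPochInf⊗q^⊗ K t X E⊗X≈1 = ≈[]-trans (≈⇒≈[] K commute)
    (≈[]-trans (q^⊗-cong[] t K E⊗X≈1) (≈⇒≈[] K (⊗-identityʳ (q^ t))))
    where
    commute : (qPochInf ⊗ (q^ t ⊗ X)) ≈ (q^ t ⊗ (qPochInf ⊗ X))
    commute = solve 3 (λ E x X → E :* (x :* X) := x :* (E :* X)) ≈-refl qPochInf (q^ t) X

  qPochInf⊗q^⊗-vanish : ∀ K t X → X ≈ 𝟘 → K ℕ.≤ t → (qPochInf ⊗ (q^ t ⊗ X)) ≈[ K ] q^ t
  qPochInf⊗q^⊗-vanish K t X X≈0 K≤t =
    ≈[]-trans (≈⇒≈[] K (⊗-zeroʳ′ qPochInf (⊗-zeroʳ′ (q^ t) X≈0))) (≈[]-sym (q^-below t K K≤t))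

qPochInf⊗jacobiPartial : ∀ n β → (qPochInf ⊗ jacobiPartial (suc n) β) ≈[ suc n ] q^ (triangleℤ β)
qPochInf⊗jacobiPartial n (+ a) with a ℕP.≤? suc n
... | yes a≤u = qPochInf⊗q^⊗ (suc n) (triangle a) _ (qPochInf⊗qBinom M (u ℕ.+ a) (u ∸ triangle a) (ℕP.+-monoʳ-≤ u a≤u) K≤ K≤′)
  where
  u = suc n
  M = u ℕ.+ u
  K≤′ : u ∸ triangle a ℕ.≤ suc (u ℕ.+ a)
  K≤′ = ℕP.≤-trans (ℕP.m∸n≤m u (triangle a)) (ℕP.≤-trans (ℕP.m≤m+n u a) (ℕP.n≤1+n _))
  K≤ : u ∸ triangle a ℕ.≤ suc (M ∸ (u ℕ.+ a))
  K≤ = subst (λ t → u ∸ triangle a ℕ.≤ suc t) (sym (ℕP.[m+n]∸[m+o]≡n∸o u u a))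
         (ℕP.≤-trans (ℕP.∸-monoʳ-≤ u (≤-triangle a)) (ℕP.n≤1+n (u ∸ a)))
... | no a≰u = qPochInf⊗q^⊗-vanish (suc n) (triangle a) _
  (qBinom-vanish (suc n ℕ.+ suc n) (suc n ℕ.+ a) (ℕP.+-monoʳ-< (suc n) (ℕP.≰⇒> a≰u)))
  (ℕP.≤-trans (ℕP.≤-trans (ℕP.n≤1+n (suc n)) (ℕP.≰⇒> a≰u)) (≤-triangle a))
qPochInf⊗jacobiPartial n -[1+ a ] with a ℕP.<? suc n
... | yes a<u = qPochInf⊗q^⊗ (suc n) (triangle a) _ λ m p →
      trans (⊗-congˡ qPochInf (qBinomDown-< M u a a<u) m)
            (qPochInf⊗qBinom M j (u ∸ triangle a) (ℕP.≤-trans (ℕP.m∸n≤m u (suc a)) (ℕP.m≤m+n u u)) K≤ K≤′ m p)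
  where
  u = suc n
  M = u ℕ.+ u
  j = u ∸ suc a
  K≤ : u ∸ triangle a ℕ.≤ suc (M ∸ j)
  K≤ = ℕP.≤-trans (ℕP.m∸n≤m u (triangle a)) (ℕP.≤-trans (subst (ℕ._≤ M ∸ j) (ℕP.m+n∸m≡n u u)
         (ℕP.∸-monoʳ-≤ M (ℕP.m∸n≤m u (suc a)))) (ℕP.n≤1+n _))
  K≤′ : u ∸ triangle a ℕ.≤ suc j
  K≤′ = ℕP.≤-trans (ℕP.∸-monoʳ-≤ u (≤-triangle a)) (ℕP.≤-reflexive (∸-suc a<u))
... | no a≮u = qPochInf⊗q^⊗-vanish (suc n) (triangle a) _
  (qBinomDown-vanish (suc n ℕ.+ suc n) (suc n) a (ℕP.≮⇒≥ a≮u)) (ℕP.≤-trans (ℕP.≮⇒≥ a≮u) (≤-triangle a))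

-- Convolution over a window of z-exponents

sumSeries : ℕ → (ℕ → Series) → Series
sumSeries zero H = 𝟘
sumSeries (suc c) H = H 0 ⊕ sumSeries c (λ i → H (suc i))

sumSeries-cong : ∀ c {H H′} → (∀ i → H i ≈ H′ i) → sumSeries c H ≈ sumSeries c H′
sumSeries-cong zero e = ≈-refl
sumSeries-cong (suc c) e = ⊕-cong (e 0) (sumSeries-cong c (λ i → e (suc i)))

sumSeries-cong[] : ∀ c {H H′} K → (∀ i → H i ≈[ K ] H′ i) → sumSeries c H ≈[ K ] sumSeries c H′
sumSeries-cong[] zero K e = λ _ _ → refl
sumSeries-cong[] (suc c) K e = ⊕-cong[] (e 0) (sumSeries-cong[] c K (λ i → e (suc i)))

sumSeries-⊕ : ∀ c H G → sumSeries c (λ i → H i ⊕ G i) ≈ (sumSeries c H ⊕ sumSeries c G)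
sumSeries-⊕ zero H G = ≈-sym (⊕-identityˡ 𝟘)
sumSeries-⊕ (suc c) H G = ≈-trans (⊕-cong ≈-refl (sumSeries-⊕ c (λ i → H (suc i)) (λ i → G (suc i))))
  (solve 4 (λ a b c d → (a :+ b) :+ (c :+ d) := (a :+ c) :+ (b :+ d)) ≈-refl (H 0) (G 0) _ _)

⊗-sumSeries : ∀ c s H → (s ⊗ sumSeries c H) ≈ sumSeries c (λ i → s ⊗ H i)
⊗-sumSeries zero s H = ⊗-zeroʳ s
⊗-sumSeries (suc c) s H = ≈-trans (⊗-distribˡ s _ _) (⊕-cong ≈-refl (⊗-sumSeries c s (λ i → H (suc i))))

sumSeries-snoc : ∀ c H → sumSeries (suc c) H ≈ (sumSeries c H ⊕ H c)
sumSeries-snoc zero H = ≈-trans (⊕-identityʳ (H 0)) (≈-sym (⊕-identityˡ (H 0)))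
sumSeries-snoc (suc c) H = ≈-trans (⊕-cong ≈-refl (sumSeries-snoc c (λ i → H (suc i)))) (≈-sym (⊕-assoc (H 0) _ _))

sumSeries-zero : ∀ c H → (∀ i → H i ≈ 𝟘) → sumSeries c H ≈ 𝟘
sumSeries-zero zero H e = ≈-refl
sumSeries-zero (suc c) H e = ≈-trans (⊕-cong (e 0) (sumSeries-zero c (λ i → H (suc i)) (λ i → e (suc i)))) (⊕-identityˡ 𝟘)

sumSeries-single : ∀ c H i₀ → i₀ ℕ.< c → (∀ i → i ≢ i₀ → H i ≈ 𝟘) → sumSeries c H ≈ H i₀
sumSeries-single (suc c) H zero _ H≈0 =
  ≈-trans (⊕-cong ≈-refl (sumSeries-zero c (λ i → H (suc i)) (λ i → H≈0 (suc i) (λ ())))) (⊕-identityʳ _)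
sumSeries-single (suc c) H (suc i₀) (s≤s i₀<c) H≈0 =
  ≈-trans (⊕-cong (H≈0 0 (λ ())) (sumSeries-single c (λ i → H (suc i)) i₀ i₀<c (λ i i≢i₀ → H≈0 (suc i) (i≢i₀ ∘ ℕP.suc-injective))))
          (⊕-identityˡ _)

sumWindow : ℕ → (ℤ → Series) → Series
sumWindow R F = sumSeries (suc (R ℕ.+ R)) (λ i → F (+ i - + R))

sumWindow-shift-up : ∀ R F → F -[1+ R ] ≈ 𝟘 → F (+ R) ≈ 𝟘 → sumWindow R (λ β → F (β - + 1)) ≈ sumWindow R F
sumWindow-shift-up R F F-R-1≈0 F+R≈0 = begin
  F (+ 0 - + R - + 1) ⊕ sumSeries c (λ i → F (+ suc i - + R - + 1))
    ≈⟨ ⊕-cong (≈-trans (ZSeries-at F (lowest R)) F-R-1≈0) (sumSeries-cong c (λ i → ZSeries-at F (step (+ i) (+ R)))) ⟩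
  𝟘 ⊕ sumSeries c (λ i → F (+ i - + R))
    ≈⟨ ≈-trans (⊕-identityˡ _) (≈-sym (⊕-identityʳ _)) ⟩
  sumSeries c (λ i → F (+ i - + R)) ⊕ 𝟘
    ≈⟨ ⊕-cong ≈-refl (≈-trans (ZSeries-at F (highest (+ R))) F+R≈0) ⟨
  sumSeries c (λ i → F (+ i - + R)) ⊕ F (+ c - + R)
    ≈⟨ sumSeries-snoc c (λ i → F (+ i - + R)) ⟨
  sumWindow R F ∎
  where
  open ≈-Reasoning
  c = R ℕ.+ R
  lowest : ∀ R → + 0 - + R - + 1 ≡ -[1+ R ]
  lowest zero = refl
  lowest (suc R) = cong (λ t → -[1+ suc t ]) (ℕP.+-identityʳ R)
  step : ∀ x r → + 1 + x - r - + 1 ≡ x - r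
  step = solveℤ
  highest : ∀ r → r + r - r ≡ r
  highest = solveℤ

sumWindow-shift-down : ∀ R F → F (+ suc R) ≈ 𝟘 → F (- + R) ≈ 𝟘 → sumWindow R (λ β → F (β - - + 1)) ≈ sumWindow R F
sumWindow-shift-down R F F+R+1≈0 F-R≈0 = begin
  sumWindow R (λ β → F (β - - + 1))
    ≈⟨ sumSeries-snoc c (λ i → F (+ i - + R - - + 1)) ⟩
  sumSeries c (λ i → F (+ i - + R - - + 1)) ⊕ F (+ c - + R - - + 1)
    ≈⟨ ⊕-cong (sumSeries-cong c (λ i → ZSeries-at F (step (+ i) (+ R)))) (≈-trans (ZSeries-at F (highest (+ R))) F+R+1≈0) ⟩
  sumSeries c (λ i → F (+ suc i - + R)) ⊕ 𝟘
    ≈⟨ ≈-trans (⊕-identityʳ _) (≈-sym (⊕-identityˡ _)) ⟩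
  𝟘 ⊕ sumSeries c (λ i → F (+ suc i - + R))
    ≈⟨ ⊕-cong (≈-trans (ZSeries-at F (lowest (+ R))) F-R≈0) ≈-refl ⟨
  sumWindow R F ∎
  where
  open ≈-Reasoning
  c = R ℕ.+ R
  lowest : ∀ r → + 0 - r ≡ - r
  lowest = solveℤ
  step : ∀ x r → x - r - - + 1 ≡ + 1 + x - r
  step = solveℤ
  highest : ∀ r → r + r - r - - + 1 ≡ + 1 + r
  highest = solveℤ

data UnitFactor : Factor → Set where
  z-factor : ∀ b → UnitFactor (+ 1 , b)
  z⁻¹-factor : ∀ b → UnitFactor (- + 1 , b)

prod-support : ∀ L → All UnitFactor L → ∀ m → length L ℕ.≤ m → (prod L (+ suc m) ≈ 𝟘) × (prod L -[1+ m ] ≈ 𝟘)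
prod-support [] _ m _ = ≈-refl , ≈-refl
prod-support ((_ , b) ∷ L) (z-factor b ∷ us) (suc m) (s≤s L≤m) =
  both-vanish (proj₁ (prod-support L us (suc m) (ℕP.m≤n⇒m≤1+n L≤m))) (proj₁ (prod-support L us m L≤m)) ,
  both-vanish (proj₂ (prod-support L us (suc m) (ℕP.m≤n⇒m≤1+n L≤m)))
    (≈-trans (ZSeries-at (prod L) (cong (λ t → -[1+ suc (suc t) ]) (ℕP.+-identityʳ m)))
             (proj₂ (prod-support L us (suc (suc m)) (ℕP.m≤n⇒m≤1+n (ℕP.m≤n⇒m≤1+n L≤m)))))
  where
  both-vanish : ∀ {A B} → A ≈ 𝟘 → B ≈ 𝟘 → (A ⊕ q^ b ⊗ B) ≈ 𝟘
  both-vanish A≈0 B≈0 = ≈-trans (⊕-cong A≈0 (⊗-zeroʳ′ (q^ b) B≈0)) (⊕-identityˡ 𝟘)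
prod-support ((_ , b) ∷ L) (z⁻¹-factor b ∷ us) (suc m) (s≤s L≤m) =
  both-vanish (proj₁ (prod-support L us (suc m) (ℕP.m≤n⇒m≤1+n L≤m)))
    (≈-trans (ZSeries-at (prod L) (cong +_ (ℕP.+-comm (suc (suc m)) 1)))
             (proj₁ (prod-support L us (suc (suc m)) (ℕP.m≤n⇒m≤1+n (ℕP.m≤n⇒m≤1+n L≤m))))) ,
  both-vanish (proj₂ (prod-support L us (suc m) (ℕP.m≤n⇒m≤1+n L≤m))) (proj₂ (prod-support L us m L≤m))
  where
  both-vanish : ∀ {A B} → A ≈ 𝟘 → B ≈ 𝟘 → (A ⊕ q^ b ⊗ B) ≈ 𝟘
  both-vanish A≈0 B≈0 = ≈-trans (⊕-cong A≈0 (⊗-zeroʳ′ (q^ b) B≈0)) (⊕-identityˡ 𝟘)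

-- Reindexing β ↦ β - a in the window is harmless because prod L vanishes near its edges.
sumWindow-reindex : ∀ R L → All UnitFactor L → ∀ {f} → UnitFactor f → suc (length L) ℕ.≤ R → ∀ (Y : ZSeries) α →
  sumWindow R (λ β → prod L (β - proj₁ f) ⊗ Y (α - β)) ≈ sumWindow R (λ β → prod L β ⊗ Y (α - proj₁ f - β))
sumWindow-reindex (suc R) L us (z-factor b) (s≤s L<R) Y α =
  ≈-trans (sumSeries-cong (suc (suc R ℕ.+ suc R)) (λ i → ≈-sym (G-shift (+ i - + suc R))))
          (sumWindow-shift-up (suc R) G (G-vanish (proj₂ (prod-support L us (suc R) (ℕP.m≤n⇒m≤1+n L<R))))
                                        (G-vanish (proj₁ (prod-support L us R L<R))))
  where
  G : ℤ → Series
  G β = prod L β ⊗ Y (α - + 1 - β)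
  cancel : ∀ α a β → α - a - (β - a) ≡ α - β
  cancel = solveℤ
  G-shift : ∀ β → G (β - + 1) ≈ (prod L (β - + 1) ⊗ Y (α - β))
  G-shift β = ⊗-congˡ _ (ZSeries-at Y (cancel α (+ 1) β))
  G-vanish : ∀ {β} → prod L β ≈ 𝟘 → G β ≈ 𝟘
  G-vanish C≈0 = ≈-trans (⊗-congʳ _ C≈0) (⊗-zeroˡ _)
sumWindow-reindex (suc R) L us (z⁻¹-factor b) (s≤s L<R) Y α =
  ≈-trans (sumSeries-cong (suc (suc R ℕ.+ suc R)) (λ i → ≈-sym (G-shift (+ i - + suc R))))
          (sumWindow-shift-down (suc R) G (G-vanish (proj₁ (prod-support L us (suc R) (ℕP.m≤n⇒m≤1+n L<R))))
                                          (G-vanish (proj₂ (prod-support L us R L<R))))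
  where
  G : ℤ → Series
  G β = prod L β ⊗ Y (α - - + 1 - β)
  cancel : ∀ α a β → α - a - (β - a) ≡ α - β
  cancel = solveℤ
  G-shift : ∀ β → G (β - - + 1) ≈ (prod L (β - - + 1) ⊗ Y (α - β))
  G-shift β = ⊗-congˡ _ (ZSeries-at Y (cancel α (- + 1) β))
  G-vanish : ∀ {β} → prod L β ≈ 𝟘 → G β ≈ 𝟘
  G-vanish C≈0 = ≈-trans (⊗-congʳ _ C≈0) (⊗-zeroˡ _)

𝟙ᶻ-off : ∀ x → x ≢ + 0 → 𝟙ᶻ x ≈ 𝟘
𝟙ᶻ-off (+ zero) x≢0 = ⊥-elim (x≢0 refl)
𝟙ᶻ-off (+ suc x) _ = ≈-refl
𝟙ᶻ-off -[1+ x ] _ = ≈-refl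

mulFactors-convolution : ∀ R L → All UnitFactor L → length L ℕ.≤ R → ∀ Y α →
  mulFactors L Y α ≈ sumWindow R (λ β → prod L β ⊗ Y (α - β))
mulFactors-convolution R [] _ _ Y α = ≈-sym (begin
  sumWindow R (λ β → 𝟙ᶻ β ⊗ Y (α - β))
    ≈⟨ sumSeries-single (suc (R ℕ.+ R)) _ R (s≤s (ℕP.m≤m+n R R)) off-centre ⟩
  𝟙ᶻ (+ R - + R) ⊗ Y (α - (+ R - + R))
    ≈⟨ ⊗-cong (ZSeries-at 𝟙ᶻ (ℤP.+-inverseʳ (+ R))) (ZSeries-at Y (cancel α (+ R))) ⟩
  𝟙 ⊗ Y α
    ≈⟨ ⊗-identityˡ _ ⟩
  Y α ∎)
  where
  open ≈-Reasoning
  cancel : ∀ α r → α - (r - r) ≡ α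
  cancel = solveℤ
  off-centre : ∀ i → i ≢ R → 𝟙ᶻ (+ i - + R) ⊗ Y (α - (+ i - + R)) ≈ 𝟘
  off-centre i i≢R = ≈-trans (⊗-congʳ _ (𝟙ᶻ-off _ (i≢R ∘ ℤP.+-injective ∘ ℤP.i-j≡0⇒i≡j (+ i) (+ R)))) (⊗-zeroˡ _)
mulFactors-convolution R ((a , b) ∷ L) (u ∷ us) L<R Y α = begin
  mulFactors L Y α ⊕ q^ b ⊗ mulFactors L Y (α - a)
    ≈⟨ ⊕-cong (mulFactors-convolution R L us L≤R Y α) (⊗-congˡ (q^ b) (mulFactors-convolution R L us L≤R Y (α - a))) ⟩
  sumWindow R (λ β → C β ⊗ Y (α - β)) ⊕ q^ b ⊗ sumWindow R (λ β → C β ⊗ Y (α - a - β))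
    ≈⟨ ⊕-cong ≈-refl (⊗-congˡ (q^ b) (sumWindow-reindex R L us u L<R Y α)) ⟨
  sumWindow R (λ β → C β ⊗ Y (α - β)) ⊕ q^ b ⊗ sumWindow R (λ β → C (β - a) ⊗ Y (α - β))
    ≈⟨ ⊕-cong ≈-refl (⊗-sumSeries c (q^ b) (λ i → C (+ i - + R - a) ⊗ Y (α - (+ i - + R)))) ⟩
  sumWindow R (λ β → C β ⊗ Y (α - β)) ⊕ sumWindow R (λ β → q^ b ⊗ (C (β - a) ⊗ Y (α - β)))
    ≈⟨ sumSeries-⊕ c (λ i → C (+ i - + R) ⊗ Y (α - (+ i - + R))) (λ i → q^ b ⊗ (C (+ i - + R - a) ⊗ Y (α - (+ i - + R)))) ⟨
  sumWindow R (λ β → C β ⊗ Y (α - β) ⊕ q^ b ⊗ (C (β - a) ⊗ Y (α - β)))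
    ≈⟨ sumSeries-cong c (λ i → solve 4 (λ c y x d → c :* y :+ x :* (d :* y) := (c :+ x :* d) :* y) ≈-refl
                                  (C (+ i - + R)) (Y (α - (+ i - + R))) (q^ b) (C (+ i - + R - a))) ⟩
  sumWindow R (λ β → (C β ⊕ q^ b ⊗ C (β - a)) ⊗ Y (α - β)) ∎
  where
  open ≈-Reasoning
  C = prod L
  c = suc (R ℕ.+ R)
  L≤R : length L ℕ.≤ R
  L≤R = ℕP.<⇒≤ L<R

jacobiFactors-unit : ∀ u → All UnitFactor (jacobiFactors u)
jacobiFactors-unit zero = []
jacobiFactors-unit (suc u) = subst (All UnitFactor) (sym (concatMap-upTo-suc (block 1) u))
  (++⁺ (jacobiFactors-unit u) (z-factor (suc u) ∷ z⁻¹-factor u ∷ []))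

length-jacobiFactors : ∀ u → length (jacobiFactors u) ≡ u ℕ.+ u
length-jacobiFactors zero = refl
length-jacobiFactors (suc u) = begin
  length (jacobiFactors (suc u))              ≡⟨ cong length (concatMap-upTo-suc (block 1) u) ⟩
  length (jacobiFactors u ++ block 1 u)       ≡⟨ LP.length-++ (jacobiFactors u) ⟩
  length (jacobiFactors u) ℕ.+ 2              ≡⟨ cong (ℕ._+ 2) (length-jacobiFactors u) ⟩
  u ℕ.+ u ℕ.+ 2                               ≡⟨ rearrange u ⟩
  suc u ℕ.+ suc u                             ∎
  where
  open ≡-Reasoning
  rearrange : ∀ u → u ℕ.+ u ℕ.+ 2 ≡ suc u ℕ.+ suc u
  rearrange = solveℕ

thetaConv : ℕ → ZSeries → ZSeries
thetaConv R Y α = sumWindow R (λ β → q^ (triangleℤ β) ⊗ Y (α - β))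

qPochInf⊗mulFactors : ∀ n R → suc n ℕ.+ suc n ℕ.≤ R → ∀ Y α →
  (qPochInf ⊗ mulFactors (factors 1 n) Y α) ≈[ suc n ] thetaConv R Y α
qPochInf⊗mulFactors n R 2n+2≤R Y α = ≈[]-trans (≈⇒≈[] (suc n) distribute)
  (sumSeries-cong[] c (suc n) (λ i → ⊗-cong[]ʳ (Y (α - (+ i - + R))) (suc n) (qPochInf⊗jacobiPartial n (+ i - + R))))
  where
  open ≈-Reasoning
  c = suc (R ℕ.+ R)
  C = prod (jacobiFactors (suc n))
  length≤R : length (jacobiFactors (suc n)) ℕ.≤ R
  length≤R = subst (ℕ._≤ R) (sym (length-jacobiFactors (suc n))) 2n+2≤R
  distribute : (qPochInf ⊗ mulFactors (factors 1 n) Y α) ≈ sumWindow R (λ β → (qPochInf ⊗ jacobiPartial (suc n) β) ⊗ Y (α - β))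
  distribute = begin
    qPochInf ⊗ mulFactors (factors 1 n) Y α
      ≈⟨ ⊗-congˡ qPochInf (mulFactors-convolution R (jacobiFactors (suc n)) (jacobiFactors-unit (suc n)) length≤R Y α) ⟩
    qPochInf ⊗ sumWindow R (λ β → C β ⊗ Y (α - β))
      ≈⟨ ⊗-sumSeries c qPochInf (λ i → C (+ i - + R) ⊗ Y (α - (+ i - + R))) ⟩
    sumWindow R (λ β → qPochInf ⊗ (C β ⊗ Y (α - β)))
      ≈⟨ sumSeries-cong c (λ i → ⊗-assoc qPochInf (C (+ i - + R)) (Y (α - (+ i - + R)))) ⟨
    sumWindow R (λ β → (qPochInf ⊗ C β) ⊗ Y (α - β))
      ≈⟨ sumSeries-cong c (λ i → ⊗-congʳ (Y (α - (+ i - + R))) (⊗-congˡ qPochInf (prod-jacobiFactors (suc n) (+ i - + R)))) ⟩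
    sumWindow R (λ β → (qPochInf ⊗ jacobiPartial (suc n) β) ⊗ Y (α - β)) ∎

qPochInf^ˢ-suc : ∀ k → (qPochInf ^ˢ suc k) ≈ (qPochInf ⊗ (qPochInf ^ˢ k))
qPochInf^ˢ-suc k n = sym (⊗-def qPochInf (qPochInf ^ˢ k) n)

qPochInf^ˢ⊗iterate : ∀ n R → suc n ℕ.+ suc n ℕ.≤ R → ∀ k α →
  ((qPochInf ^ˢ k) ⊗ iterate k (mulFactors (factors 1 n)) 𝟙ᶻ α) ≈[ suc n ] iterate k (thetaConv R) 𝟙ᶻ α
qPochInf^ˢ⊗iterate n R 2n+2≤R zero α = ≈⇒≈[] (suc n) (⊗-identityˡ (𝟙ᶻ α))
qPochInf^ˢ⊗iterate n R 2n+2≤R (suc k) α = ≈[]-trans (≈⇒≈[] (suc n) regroup)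
  (≈[]-trans (⊗-cong[]ˡ qPochInf (suc n) (mulFactors-cong[] (factors 1 n) (suc n) (qPochInf^ˢ⊗iterate n R 2n+2≤R k) α))
             (qPochInf⊗mulFactors n R 2n+2≤R (iterate k (thetaConv R) 𝟙ᶻ) α))
  where
  open ≈-Reasoning
  F = mulFactors (factors 1 n)
  X = iterate k F 𝟙ᶻ
  regroup : ((qPochInf ^ˢ suc k) ⊗ F X α) ≈ (qPochInf ⊗ F ((qPochInf ^ˢ k) ·ᶻ X) α)
  regroup = begin
    (qPochInf ^ˢ suc k) ⊗ F X α              ≈⟨ ⊗-congʳ _ (qPochInf^ˢ-suc k) ⟩
    (qPochInf ⊗ (qPochInf ^ˢ k)) ⊗ F X α     ≈⟨ ⊗-assoc _ _ _ ⟩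
    qPochInf ⊗ ((qPochInf ^ˢ k) ⊗ F X α)     ≈⟨ ⊗-congˡ qPochInf (mulFactors-·ᶻ (factors 1 n) (qPochInf ^ˢ k) X α) ⟨
    qPochInf ⊗ F ((qPochInf ^ˢ k) ·ᶻ X) α    ∎

-- The 2n+2 factors that matter for q^n have z-degrees in [-(2n+2), 2n+2].
window : ℕ → ℕ
window n = suc n ℕ.+ suc n

qPochInf^ˢ⊛CΦ : ∀ k α n → ((qPochInf ^ˢ k) ⊛ CΦ k α) n ≡ iterate k (thetaConv (window n)) 𝟙ᶻ α n
qPochInf^ˢ⊛CΦ k α n = begin
  ((qPochInf ^ˢ k) ⊛ CΦ k α) n
    ≡⟨ ⊛-cong[] {qPochInf ^ˢ k} {qPochInf ^ˢ k} (suc n) (λ _ _ → refl) (CΦ≈[]prod k α n) n ℕP.≤-refl ⟩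
  ((qPochInf ^ˢ k) ⊛ prod (factors k n) α) n
    ≡⟨ ⊗-def (qPochInf ^ˢ k) _ n ⟨
  ((qPochInf ^ˢ k) ⊗ prod (factors k n) α) n
    ≡⟨ ⊗-congˡ (qPochInf ^ˢ k) (mulFactors-factors k n 𝟙ᶻ α) n ⟩
  ((qPochInf ^ˢ k) ⊗ iterate k (mulFactors (factors 1 n)) 𝟙ᶻ α) n
    ≡⟨ qPochInf^ˢ⊗iterate n (window n) ℕP.≤-refl k α n ℕP.≤-refl ⟩
  iterate k (thetaConv (window n)) 𝟙ᶻ α n ∎
  where open ≡-Reasoning

-- Counting the coefficients

countIf : ∀ {P : Set} → Dec P → ℕ → ℕ
countIf (yes _) x = x
countIf (no _) x = 0

sumℕ : ℕ → (ℕ → ℕ) → ℕ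
sumℕ zero f = 0
sumℕ (suc c) f = f 0 ℕ.+ sumℕ c (λ i → f (suc i))

windowPoint : ℕ → ℕ → ℤ
windowPoint R i = + i - + R

-- The number of β ∈ [-R, R]^k with Σ β = α and Σ β(β+1)/2 = m.
thetaCount : ℕ → ℕ → ℤ → ℕ → ℕ
thetaCount R zero (+ zero) zero = 1
thetaCount R zero (+ zero) (suc m) = 0
thetaCount R zero (+ suc a) m = 0
thetaCount R zero -[1+ a ] m = 0
thetaCount R (suc k) α m = sumℕ (suc (R ℕ.+ R)) λ i →
  countIf (triangleℤ (windowPoint R i) ℕP.≤? m) (thetaCount R k (α - windowPoint R i) (m ∸ triangleℤ (windowPoint R i)))

sumSeries-at : ∀ c H m f → (∀ i → H i m ≡ + f i) → sumSeries c H m ≡ + sumℕ c f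
sumSeries-at zero H m f H≡f = refl
sumSeries-at (suc c) H m f H≡f = trans (⊕-def (H 0) _ m)
  (trans (cong₂ _+_ (H≡f 0) (sumSeries-at c (λ i → H (suc i)) m (λ i → f (suc i)) (λ i → H≡f (suc i))))
         (sym (ℤP.pos-+ (f 0) _)))

q^⊗-at : ∀ t (Y : Series) m y → (t ℕ.≤ m → Y (m ∸ t) ≡ + y) → (q^ t ⊗ Y) m ≡ + countIf (t ℕP.≤? m) y
q^⊗-at t Y m y Y≡y with t ℕP.≤? m
... | yes t≤m = trans (q^⊗ t Y m) (trans (shift-above t Y m t≤m) (Y≡y t≤m))
... | no t≰m = trans (q^⊗ t Y m) (shift-below t Y m (ℕP.≰⇒> t≰m))

iterate-thetaConv : ∀ R k α m → iterate k (thetaConv R) 𝟙ᶻ α m ≡ + thetaCount R k α m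
iterate-thetaConv R zero (+ zero) zero = refl
iterate-thetaConv R zero (+ zero) (suc m) = refl
iterate-thetaConv R zero (+ suc a) m = refl
iterate-thetaConv R zero -[1+ a ] m = refl
iterate-thetaConv R (suc k) α m = sumSeries-at (suc (R ℕ.+ R)) (λ i → q^ (triangleℤ (β i)) ⊗ iterate k (thetaConv R) 𝟙ᶻ (α - β i)) m _ λ i →
  q^⊗-at (triangleℤ (β i)) (iterate k (thetaConv R) 𝟙ᶻ (α - β i)) m _ λ _ →
    iterate-thetaConv R k (α - β i) (m ∸ triangleℤ (β i))
  where
  β = windowPoint R

-- Solutions of 2Q = 2m as decompositions into triangular numbers

twice-triangle : ∀ a → 2 ℕ.* triangle a ≡ a ℕ.* a ℕ.+ a
twice-triangle zero = refl
twice-triangle (suc a) = trans (ℕP.*-distribˡ-+ 2 (triangle a) (suc a)) (trans (cong (ℕ._+ 2 ℕ.* suc a) (twice-triangle a)) (expand a))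
  where
  expand : ∀ a → a ℕ.* a ℕ.+ a ℕ.+ 2 ℕ.* suc a ≡ suc a ℕ.* suc a ℕ.+ suc a
  expand = solveℕ

module _ where
  open import Data.Integer using (_*_)

  twice-triangleℤ : ∀ x → + (2 ℕ.* triangleℤ x) ≡ x * x + x
  twice-triangleℤ (+ a) = trans (cong +_ (twice-triangle a)) (trans (ℤP.pos-+ (a ℕ.* a) a) (cong (_+ + a) (ℤP.pos-* a a)))
  twice-triangleℤ -[1+ a ] = trans (twice-triangleℤ (+ a)) (reflect (+ a))
    where
    reflect : ∀ y → y * y + y ≡ (- (+ 1 + y)) * (- (+ 1 + y)) + (- (+ 1 + y))
    reflect = solveℤ

  twiceQ-[] : ∀ α → twiceQ α [] ≡ + (2 ℕ.* triangleℤ α)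
  twiceQ-[] α = trans (simplify α) (sym (twice-triangleℤ α))
    where
    simplify : ∀ α → + 2 * (+ 0 - α * + 0 + + 0) + (α * α + α) ≡ α * α + α
    simplify = solveℤ

  twiceQ-∷ : ∀ {r} α x (v : Vec ℤ r) → twiceQ α (x ∷ v) ≡ + (2 ℕ.* triangleℤ x) + twiceQ (α - x) v
  twiceQ-∷ α x v = trans (split α x (sumSq v) (sumℤ v) (pairSum v)) (cong (_+ twiceQ (α - x) v) (sym (twice-triangleℤ x)))
    where
    split : ∀ α x s₂ s₁ p → + 2 * ((x * x + s₂) - α * (x + s₁) + (x * s₁ + p)) + (α * α + α)
                           ≡ (x * x + x) + (+ 2 * (s₂ - (α - x) * s₁ + p) + ((α - x) * (α - x) + (α - x)))
    split = solveℤ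

  twiceQ-nonneg : ∀ {r} α (v : Vec ℤ r) → Σ[ k ∈ ℕ ] twiceQ α v ≡ + k
  twiceQ-nonneg α [] = _ , twiceQ-[] α
  twiceQ-nonneg α (x ∷ v) with twiceQ-nonneg (α - x) v
  ... | k , Q≡k = 2 ℕ.* triangleℤ x ℕ.+ k , trans (twiceQ-∷ α x v) (trans (cong (_+_ (+ (2 ℕ.* triangleℤ x))) Q≡k) (sym (ℤP.pos-+ _ k)))

Solutions : ℕ → ℤ → ℕ → Set
Solutions r α m = Σ[ v ∈ Vec ℤ r ] twiceQ α v ≡ + (2 ℕ.* m)

TriangleSums : ℕ → ℤ → ℕ → Set
TriangleSums zero α m = (α ≡ + 0) × (m ≡ 0)
TriangleSums (suc k) α m = Σ[ x ∈ ℤ ] (triangleℤ x ℕ.≤ m × TriangleSums k (α - x) (m ∸ triangleℤ x))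

private
  ≡-irrelevantℤ : ∀ {x y : ℤ} (p q : x ≡ y) → p ≡ q
  ≡-irrelevantℤ = Decidable⇒UIP.≡-irrelevant ℤ._≟_

Solutions-zero↔ : ∀ α m → Solutions 0 α m ↔ TriangleSums 1 α m
Solutions-zero↔ α m = mk↔ₛ′ to from to-from from-to
  where
  to : Solutions 0 α m → TriangleSums 1 α m
  to ([] , Q≡) = α , ℕP.≤-reflexive t≡m , ℤP.+-inverseʳ α , trans (cong (m ∸_) t≡m) (ℕP.n∸n≡0 m)
    where
    t≡m : triangleℤ α ≡ m
    t≡m = ℕP.*-cancelˡ-≡ (triangleℤ α) m 2 (ℤP.+-injective (trans (sym (twiceQ-[] α)) Q≡))
  from : TriangleSums 1 α m → Solutions 0 α m
  from (x , t≤m , α-x≡0 , m-t≡0) = [] , (begin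
    twiceQ α []                  ≡⟨ twiceQ-[] α ⟩
    + (2 ℕ.* triangleℤ α)        ≡⟨ cong (λ y → + (2 ℕ.* triangleℤ y)) (ℤP.i-j≡0⇒i≡j α x α-x≡0) ⟩
    + (2 ℕ.* triangleℤ x)        ≡⟨ cong (λ t → + (2 ℕ.* t)) (ℕP.≤-antisym t≤m (ℕP.m∸n≡0⇒m≤n m-t≡0)) ⟩
    + (2 ℕ.* m)                  ∎)
    where open ≡-Reasoning
  from-to : ∀ s → from (to s) ≡ s
  from-to ([] , Q≡) = cong ([] ,_) (≡-irrelevantℤ _ _)
  to-from : ∀ s → to (from s) ≡ s
  to-from (x , t≤m , α-x≡0 , m-t≡0) with ℤP.i-j≡0⇒i≡j α x α-x≡0
  ... | refl = cong (α ,_) (cong₂ _,_ (ℕP.≤-irrelevant _ _) (cong₂ _,_ (≡-irrelevantℤ _ _) (ℕP.≡-irrelevant _ _)))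

Solutions-suc↔ : ∀ r α m → Solutions (suc r) α m ↔ (Σ[ x ∈ ℤ ] (triangleℤ x ℕ.≤ m × Solutions r (α - x) (m ∸ triangleℤ x)))
Solutions-suc↔ r α m = mk↔ₛ′ to from to-from from-to
  where
  peel : ∀ x v → twiceQ α (x ∷ v) ≡ + (2 ℕ.* m) → triangleℤ x ℕ.≤ m × twiceQ (α - x) v ≡ + (2 ℕ.* (m ∸ triangleℤ x))
  peel x v Q≡ with twiceQ-nonneg (α - x) v
  ... | k , Q′≡k = t≤m , trans Q′≡k (cong +_ k≡)
    where
    t = triangleℤ x
    2t+k≡2m : 2 ℕ.* t ℕ.+ k ≡ 2 ℕ.* m
    2t+k≡2m = ℤP.+-injective (trans (ℤP.pos-+ (2 ℕ.* t) k)
                (trans (cong (_+_ (+ (2 ℕ.* t))) (sym Q′≡k)) (trans (sym (twiceQ-∷ α x v)) Q≡)))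
    t≤m : t ℕ.≤ m
    t≤m = ℕP.*-cancelˡ-≤ 2 (subst (2 ℕ.* t ℕ.≤_) 2t+k≡2m (ℕP.m≤m+n (2 ℕ.* t) k))
    k≡ : k ≡ 2 ℕ.* (m ∸ t)
    k≡ = sym (trans (ℕP.*-distribˡ-∸ 2 m t) (trans (cong (_∸ 2 ℕ.* t) (sym 2t+k≡2m)) (ℕP.m+n∸m≡n (2 ℕ.* t) k)))
  to : Solutions (suc r) α m → Σ[ x ∈ ℤ ] (triangleℤ x ℕ.≤ m × Solutions r (α - x) (m ∸ triangleℤ x))
  to (x ∷ v , Q≡) = x , proj₁ (peel x v Q≡) , v , proj₂ (peel x v Q≡)
  from : Σ[ x ∈ ℤ ] (triangleℤ x ℕ.≤ m × Solutions r (α - x) (m ∸ triangleℤ x)) → Solutions (suc r) α m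
  from (x , t≤m , v , Q≡) = x ∷ v , (begin
    twiceQ α (x ∷ v)                                      ≡⟨ twiceQ-∷ α x v ⟩
    + (2 ℕ.* t) + twiceQ (α - x) v                        ≡⟨ cong (_+_ (+ (2 ℕ.* t))) Q≡ ⟩
    + (2 ℕ.* t) + + (2 ℕ.* (m ∸ t))                       ≡⟨ ℤP.pos-+ (2 ℕ.* t) _ ⟨
    + (2 ℕ.* t ℕ.+ 2 ℕ.* (m ∸ t))                         ≡⟨ cong +_ (ℕP.*-distribˡ-+ 2 t (m ∸ t)) ⟨
    + (2 ℕ.* (t ℕ.+ (m ∸ t)))                             ≡⟨ cong (λ y → + (2 ℕ.* y)) (ℕP.m+[n∸m]≡n t≤m) ⟩
    + (2 ℕ.* m)                                           ∎)
    where
    open ≡-Reasoning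
    t = triangleℤ x
  from-to : ∀ s → from (to s) ≡ s
  from-to (x ∷ v , Q≡) = cong (x ∷ v ,_) (≡-irrelevantℤ _ _)
  to-from : ∀ s → to (from s) ≡ s
  to-from (x , t≤m , v , Q≡) = cong (x ,_) (cong₂ _,_ (ℕP.≤-irrelevant _ _) (cong (v ,_) (≡-irrelevantℤ _ _)))

Solutions↔TriangleSums : ∀ r α m → Solutions r α m ↔ TriangleSums (suc r) α m
Solutions↔TriangleSums zero α m = Solutions-zero↔ α m
Solutions↔TriangleSums (suc r) α m =
  ↔-trans (Solutions-suc↔ r α m) (Σ.congˡ λ {x} → ↔-refl ×-↔ Solutions↔TriangleSums r (α - x) (m ∸ triangleℤ x))

Σ-↔-image : ∀ {c} (β : Fin c → ℤ) → (∀ i j → β i ≡ β j → i ≡ j) → (P : ℤ → Set) →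
            (∀ x → P x → Σ[ i ∈ Fin c ] β i ≡ x) → (Σ ℤ P) ↔ (Σ[ i ∈ Fin c ] P (β i))
Σ-↔-image β β-injective P in-image = mk↔ₛ′ to from to-from from-to
  where
  to : Σ ℤ P → Σ[ i ∈ Fin _ ] P (β i)
  to (x , p) = proj₁ (in-image x p) , subst P (sym (proj₂ (in-image x p))) p
  from : Σ[ i ∈ Fin _ ] P (β i) → Σ ℤ P
  from (i , p) = β i , p
  from-to : ∀ xp → from (to xp) ≡ xp
  from-to (x , p) = pair (proj₂ (in-image x p)) p
    where
    pair : ∀ {y x} (y≡x : y ≡ x) p → (y , subst P (sym y≡x) p) ≡ (x , p)
    pair refl p = refl
  to-from : ∀ ip → to (from ip) ≡ ip
  to-from (i , p) = pair (β-injective _ _ (proj₂ (in-image (β i) p))) (proj₂ (in-image (β i) p)) p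
    where
    pair : ∀ {j i} (j≡i : j ≡ i) (βj≡βi : β j ≡ β i) p → (j , subst P (sym βj≡βi) p) ≡ (i , p)
    pair refl refl p = refl

windowPointFin : ∀ R → Fin (suc (R ℕ.+ R)) → ℤ
windowPointFin R i = windowPoint R (toℕ i)

windowPointFin-injective : ∀ R i j → windowPointFin R i ≡ windowPointFin R j → i ≡ j
windowPointFin-injective R i j βi≡βj =
  FP.toℕ-injective (ℤP.+-injective (trans (sym (cancel (+ toℕ i) (+ R))) (trans (cong (_+ + R) βi≡βj) (cancel (+ toℕ j) (+ R)))))
  where
  cancel : ∀ x r → x - r + r ≡ x
  cancel = solveℤ

in-window : ∀ R n → suc n ℕ.≤ R → ∀ x m → m ℕ.≤ n → triangleℤ x ℕ.≤ m → Σ[ i ∈ Fin (suc (R ℕ.+ R)) ] windowPointFin R i ≡ x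
in-window R n n<R (+ a) m m≤n t≤m = fromℕ< a+R<c , (begin
  + toℕ (fromℕ< a+R<c) - + R      ≡⟨ cong (λ t → + t - + R) (FP.toℕ-fromℕ< a+R<c) ⟩
  + (a ℕ.+ R) - + R               ≡⟨ cong (_- + R) (ℤP.pos-+ a R) ⟩
  + a + + R - + R                 ≡⟨ cancel (+ a) (+ R) ⟩
  + a                             ∎)
  where
  open ≡-Reasoning
  a≤R : a ℕ.≤ R
  a≤R = ℕP.≤-trans (≤-triangle a) (ℕP.≤-trans t≤m (ℕP.≤-trans m≤n (ℕP.≤-trans (ℕP.n≤1+n n) n<R)))
  a+R<c : a ℕ.+ R ℕ.< suc (R ℕ.+ R)
  a+R<c = s≤s (ℕP.+-monoˡ-≤ R a≤R)
  cancel : ∀ a r → a + r - r ≡ a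
  cancel = solveℤ
in-window R n n<R -[1+ a ] m m≤n t≤m = fromℕ< d<c , (begin
  + toℕ (fromℕ< d<c) - + R        ≡⟨ cong (λ t → + t - + R) (FP.toℕ-fromℕ< d<c) ⟩
  + d - + R                       ≡⟨ cong (λ t → + d - + t) a+d≡R ⟨
  + d - + (suc a ℕ.+ d)           ≡⟨ cong (λ t → + d - t) (ℤP.pos-+ (suc a) d) ⟩
  + d - (+ suc a + + d)           ≡⟨ cancel (+ suc a) (+ d) ⟩
  -[1+ a ]                        ∎)
  where
  open ≡-Reasoning
  d = R ∸ suc a
  a<R : suc a ℕ.≤ R
  a<R = ℕP.≤-trans (s≤s (ℕP.≤-trans (≤-triangle a) (ℕP.≤-trans t≤m m≤n))) n<R
  a+d≡R : suc a ℕ.+ d ≡ R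
  a+d≡R = ℕP.m+[n∸m]≡n a<R
  d<c : d ℕ.< suc (R ℕ.+ R)
  d<c = s≤s (ℕP.≤-trans (ℕP.m∸n≤m R (suc a)) (ℕP.m≤m+n R R))
  cancel : ∀ s d → d - (s + d) ≡ - s
  cancel = solveℤ

Fin-sumℕ↔ : ∀ c f → Fin (sumℕ c f) ↔ (Σ[ i ∈ Fin c ] Fin (f (toℕ i)))
Fin-sumℕ↔ zero f = mk↔ₛ′ (λ ()) (λ ()) (λ ()) (λ ())
Fin-sumℕ↔ (suc c) f = ↔-trans FP.+↔⊎ (↔-trans (↔-refl ⊎-↔ Fin-sumℕ↔ c (λ i → f (suc i))) split-zero)
  where
  split-zero : (Fin (f 0) ⊎ Σ[ i ∈ Fin c ] Fin (f (suc (toℕ i)))) ↔ (Σ[ i ∈ Fin (suc c) ] Fin (f (toℕ i)))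
  split-zero = mk↔ₛ′ (λ { (inj₁ b) → Fin.zero , b ; (inj₂ (i , b)) → Fin.suc i , b })
                     (λ { (Fin.zero , b) → inj₁ b ; (Fin.suc i , b) → inj₂ (i , b) })
                     (λ { (Fin.zero , b) → refl ; (Fin.suc i , b) → refl })
                     (λ { (inj₁ b) → refl ; (inj₂ (i , b)) → refl })

Fin-countIf↔ : ∀ {P : Set} (d : Dec P) x → (∀ (p q : P) → p ≡ q) → Fin (countIf d x) ↔ (P × Fin x)
Fin-countIf↔ (yes p) x P-irrelevant = mk↔ₛ′ (p ,_) proj₂ (λ { (q , i) → cong (_, i) (P-irrelevant p q) }) (λ i → refl)
Fin-countIf↔ (no ¬p) x _ = mk↔ₛ′ (λ ()) (λ { (p , _) → contradiction p ¬p }) (λ { (p , _) → contradiction p ¬p }) (λ ())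

Fin-thetaCount-zero↔ : ∀ R γ m → Fin (thetaCount R 0 γ m) ↔ TriangleSums 0 γ m
Fin-thetaCount-zero↔ R (+ zero) zero = mk↔ₛ′ (λ _ → refl , refl) (λ _ → Fin.zero) (λ { (refl , refl) → refl }) (λ { Fin.zero → refl ; (Fin.suc ()) })
Fin-thetaCount-zero↔ R (+ zero) (suc m) = mk↔ₛ′ (λ ()) (λ { (_ , ()) }) (λ { (_ , ()) }) (λ ())
Fin-thetaCount-zero↔ R (+ suc a) m = mk↔ₛ′ (λ ()) (λ { (() , _) }) (λ { (() , _) }) (λ ())
Fin-thetaCount-zero↔ R -[1+ a ] m = mk↔ₛ′ (λ ()) (λ { (() , _) }) (λ { (() , _) }) (λ ())

Fin-thetaCount-suc↔ : ∀ R k α m → Fin (thetaCount R (suc k) α m) ↔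
  (Σ[ i ∈ Fin (suc (R ℕ.+ R)) ] (triangleℤ (windowPointFin R i) ℕ.≤ m
    × Fin (thetaCount R k (α - windowPointFin R i) (m ∸ triangleℤ (windowPointFin R i)))))
Fin-thetaCount-suc↔ R k α m = ↔-trans (Fin-sumℕ↔ (suc (R ℕ.+ R)) λ i →
    countIf (triangleℤ (windowPoint R i) ℕP.≤? m) (thetaCount R k (α - windowPoint R i) (m ∸ triangleℤ (windowPoint R i))))
  (Σ.congˡ λ {i} → Fin-countIf↔ (triangleℤ (windowPointFin R i) ℕP.≤? m) _ ℕP.≤-irrelevant)

TriangleSums↔Fin : ∀ R n → suc n ℕ.≤ R → ∀ k α m → m ℕ.≤ n → TriangleSums k α m ↔ Fin (thetaCount R k α m)
TriangleSums↔Fin R n n<R zero α m m≤n = ↔-sym (Fin-thetaCount-zero↔ R α m)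
TriangleSums↔Fin R n n<R (suc k) α m m≤n = ↔-trans
  (Σ-↔-image β (windowPointFin-injective R) (λ x → triangleℤ x ℕ.≤ m × TriangleSums k (α - x) (m ∸ triangleℤ x))
              (λ x p → in-window R n n<R x m m≤n (proj₁ p)))
  (↔-trans (Σ.congˡ λ {i} → ↔-refl ×-↔ TriangleSums↔Fin R n n<R k (α - β i) (m ∸ triangleℤ (β i)) (ℕP.≤-trans (ℕP.m∸n≤m m (triangleℤ (β i))) m≤n))
           (↔-sym (Fin-thetaCount-suc↔ R k α m)))
  where
  β = windowPointFin R

open import Data.Nat using (_≤_; _*_)

theorem2 : (k : ℕ) → 1 ≤ k → (α : ℤ) → (n : ℕ) →
    Σ[ c ∈ ℕ ] (((qPochInf ^ˢ k) ⊛ CΦ k α) n ≡ + c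
    × ((Σ[ m ∈ Vec ℤ (k ∸ 1) ] twiceQ α m ≡ + (2 * n)) ↔ Fin c))
theorem2 (suc r) _ α n = thetaCount R (suc r) α n ,
  trans (qPochInf^ˢ⊛CΦ (suc r) α n) (iterate-thetaConv R (suc r) α n) ,
  ↔-trans (Solutions↔TriangleSums r α n) (TriangleSums↔Fin R n (ℕP.m≤m+n (suc n) (suc n)) (suc r) α n ℕP.≤-refl)
  where
  R = window n
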